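{- There is an algorithm (GeneratePN) which, given $n$, lists every prefix normal word of length $n$ exactly once, in amortized $O(n)$ time per word listed. That is, its total running time is $O\big(n\cdot |\mathcal{L}_{\mathrm{PN}}\cap\{0,1\}^n|\big)$.
   Context: A binary word $w=w_1\cdots w_n\in\{0,1\}^n$ is prefix normal if for every $1\le i\le n$, no length-$i$ substring (factor) of $w$ contains more $1$s than the prefix $w_1\cdots w_i$. Equivalently, $F(w,i)=P(w,i)$ for all $i$, where $P(w,i)$ is the number of $1$s in $w_1\cdots w_i$ and $F(w,i)$ is the maximum number of $1$s over all length-$i$ substrings of $w$. $\mathcal{L}_{\mathrm{PN}}$ denotes the set of prefix normal words. The algorithm works as follows. For each density $d=0,1,\dots,n$, it starts at the word $1^d0^{n-d}$ and explores recursively. From a word $1^s0^t\gamma$ (with $s,t>0$ and $\gamma$ empty or starting with $1$), it considers the children $1^{s-1}0^i10^{t-i}\gamma$ for $i=1,2,\dots$ in increasing order of $i$. It recurses into each child as long as that child is prefix normal, and it stops at the first child that is not prefix normal. Each visited word is output. The algorithm maintains an array holding the function $F(\gamma,\cdot)$ for the fixed suffix $\gamma$. -}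

module Defs where

open import Data.Bool using (Bool; true; false; if_then_else_; _∧_)
open import Data.Nat using (ℕ; zero; suc; _+_; _*_; _∸_; _≤_; _⊔_; _≤ᵇ_; _<ᵇ_)
open import Data.List using (List; []; _∷_; _++_; replicate; take; drop; length)
open import Data.Product using (_×_; _,_; proj₁; proj₂)

-- Binary words: true = 1, false = 0.

Word : Set
Word = List Bool

ones : Word → ℕ
ones []          = 0
ones (true ∷ w)  = suc (ones w)
ones (false ∷ w) = ones w

P : Word → ℕ → ℕ
P w i = ones (take i w)

factor : Word → ℕ → ℕ → Word
factor w j i = take i (drop j w)

PrefixNormal : Word → Set
PrefixNormal w = ∀ i j → j + i ≤ length w → ones (factor w j i) ≤ P w i

-- The algorithm GeneratePN, instrumented with a step counter
-- (unit-cost RAM model: array lookups and arithmetic cost O(1);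
--  every loop iteration is charged one step; writing a word of length n
--  is charged n steps; materialising an array of length k is charged k).

-- Data maintained for the fixed suffix γ: the word itself, its length g,
-- and the arrays  Pg k = P(γ,k)  and  Fg ℓ = F(γ,ℓ)  (as lookup tables).
record GInfo : Set where
  field
    γ  : Word
    g  : ℕ
    Pg : ℕ → ℕ
    Fg : ℕ → ℕ
open GInfo public

emptyInfo : GInfo
emptyInfo = record { γ = [] ; g = 0 ; Pg = λ _ → 0 ; Fg = λ _ → 0 }

extend : ℕ → GInfo → GInfo
extend z info = record
  { γ  = true ∷ (replicate z false ++ γ info)
  ; g  = suc (z + g info)
  ; Pg = Pg'
  ; Fg = Fg'
  }
  where
  Pg' : ℕ → ℕ
  Pg' zero    = 0
  Pg' (suc k) = suc (Pg info (k ∸ z))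
  Fg' : ℕ → ℕ
  Fg' zero     = 0
  Fg' (suc ℓ′) = suc (Pg info (ℓ′ ∸ z))
                 ⊔ (if suc ℓ′ ≤ᵇ g info then Fg info (suc ℓ′) else Pg info (g info))

extendCost : ℕ → GInfo → ℕ
extendCost z info = suc (suc (z + g info))

checkLoop : ℕ → ℕ → (ℕ → Bool) → Bool × ℕ
checkLoop zero    ℓ cond = true , 0
checkLoop (suc k) ℓ cond =
  if cond ℓ then (proj₁ r , suc (proj₂ r)) else (false , 1)
  where r = checkLoop k (suc ℓ) cond

-- Is the child 1^(s-1) 0^i 1 0^(t-i) γ of 1^s 0^t γ prefix normal?
-- (requires s ≥ 1, 1 ≤ i ≤ t).  For each length ℓ the candidate factors
-- are: the prefix, the factor starting at the moved 1, the factors inside γ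
-- (via F(γ,·)) and the suffix of length ℓ.
childTest : (s t i : ℕ) → GInfo → Bool × ℕ
childTest s t i info = checkLoop n 1 cond
  where
  z  = t ∸ i
  m  = s + t
  gg = g info
  n  = m + gg
  o  = Pg info gg
  pre : ℕ → ℕ
  pre ℓ = if ℓ ≤ᵇ s ∸ 1 then ℓ
          else if ℓ <ᵇ s + i then s ∸ 1
          else if ℓ ≤ᵇ m then s
          else s + Pg info (ℓ ∸ m)
  candB : ℕ → ℕ
  candB ℓ = if s + i ∸ 1 + ℓ ≤ᵇ n then suc (Pg info ((ℓ ∸ 1) ∸ z)) else 0
  candC : ℕ → ℕ
  candC ℓ = if ℓ ≤ᵇ gg then Fg info ℓ else 0
  sufU : ℕ → ℕ
  sufU r = if r ≤ᵇ z then 0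
           else if r ≤ᵇ suc (z + i) then 1
           else suc (r ∸ suc (z + i))
  candD : ℕ → ℕ
  candD ℓ = if ℓ ≤ᵇ gg then 0 else o + sufU (ℓ ∸ gg)
  cond : ℕ → Bool
  cond ℓ = (candB ℓ ≤ᵇ pre ℓ) ∧ ((candC ℓ ≤ᵇ pre ℓ) ∧ (candD ℓ ≤ᵇ pre ℓ))

node : ℕ → ℕ → GInfo → Word
node s t info = replicate s true ++ (replicate t false ++ γ info)

nodeLen : ℕ → ℕ → GInfo → ℕ
nodeLen s t info = s + t + g info

mutual
  visit : (s t : ℕ) → GInfo → List Word × ℕ
  visit zero     t info = node zero t info ∷ [] , nodeLen zero t info
  visit (suc s′) t info =
    node (suc s′) t info ∷ proj₁ r , nodeLen (suc s′) t info + proj₂ r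
    where r = kids s′ t 1 t info

  kids : (s′ t i k : ℕ) → GInfo → List Word × ℕ
  kids s′ t i zero    info = [] , 0
  kids s′ t i (suc k) info =
    kidsStep (childTest (suc s′) t i info)
             (visit s′ i (extend (t ∸ i) info))
             (kids s′ t (suc i) k info)
             (extendCost (t ∸ i) info)

  kidsStep : Bool × ℕ → List Word × ℕ → List Word × ℕ → ℕ → List Word × ℕ
  kidsStep (false , c) child rest e = [] , c
  kidsStep (true  , c) child rest e =
    proj₁ child ++ proj₁ rest , c + e + proj₂ child + proj₂ rest

densities : (n d k : ℕ) → List Word × ℕ
densities n d zero    = [] , 0
densities n d (suc k) =
  proj₁ v ++ proj₁ rest , suc (proj₂ v + proj₂ rest)
  where
  v    = visit d (n ∸ d) emptyInfo
  rest = densities n (suc d) k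

generatePN : ℕ → List Word × ℕ
generatePN n = densities n 0 (suc n)

generatePN-output : ℕ → List Word
generatePN-output n = proj₁ (generatePN n)

generatePN-time : ℕ → ℕ
generatePN-time n = proj₂ (generatePN n)

-- The words of length n with d ones form a tree rooted at 1^d 0^(n-d): the children of 1^s 0^t γ
-- (with γ empty or starting with 1) are the words 1^(s-1) 0^i 1 0^(t-i) γ.  A prefix normal word u γ,
-- where u holds the first s ones and t zeros, has as parent the word obtained by sorting u to 1^s 0^t,
-- which is again prefix normal; so the prefix normal words are exactly the prefix normal nodes of these
-- trees, each reached once.  Among siblings prefix normality passes from the i-th child to all earlier
-- ones, so the search may stop at the first failing child.  A child is tested in O(n) steps by comparing
-- its prefix counts only with factors starting at the moved 1, factors inside γ (through the array
-- F(γ,·)) and suffixes, and F is rebuilt in O(n) steps when descending.  Charging a successful test and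
-- the rebuild to the child produced, and the one failing test to its parent, gives at most 6n steps
-- per word listed.
module Submission where

open import Data.Bool using (Bool; true; false; if_then_else_; _∧_; T)
open import Data.Bool.Properties using (T-∧)
open import Data.Empty using (⊥-elim)
open import Data.List using (List; []; _∷_; _++_; replicate; drop; length)
open import Data.List.Properties using (length-++; length-replicate; ++-assoc; ++-identityʳ)
open import Data.List.Membership.Propositional using (_∈_)
open import Data.List.Membership.Propositional.Properties using (∈-++⁺ˡ; ∈-++⁺ʳ; ∈-++⁻)
open import Data.List.Relation.Unary.Any using (here)
import Data.List.Relation.Unary.All as All
import Data.List.Relation.Unary.AllPairs as AllPairs
open import Data.List.Relation.Unary.Unique.Propositional using (Unique)
open import Data.List.Relation.Unary.Unique.Propositional.Properties using (++⁺)
open import Data.Nat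
open import Data.Nat.Properties
open import Data.Nat.Tactic.RingSolver using (solve-∀)
open import Data.Product using (Σ; _×_; _,_; proj₁; proj₂)
open import Data.Sum using (_⊎_; inj₁; inj₂)
open import Data.Unit using (tt)
open import Function.Bundles using (_⇔_; mk⇔; Equivalence)
open import Relation.Binary.PropositionalEquality
open import Relation.Nullary using (¬_; yes; no)
open import Defs

≤-offset : ∀ {m n} → m ≤ n → Σ ℕ λ k → n ≡ m + k
≤-offset {n = n} z≤n = n , refl
≤-offset (s≤s m≤n) with ≤-offset m≤n
... | k , eq = k , cong suc eq

if-≤ᵇ-yes : ∀ {A : Set} {m n} {x y : A} → m ≤ n → (if m ≤ᵇ n then x else y) ≡ x
if-≤ᵇ-yes {m = m} {n} m≤n with m ≤ᵇ n | ≤⇒≤ᵇ m≤n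
... | true | _ = refl

if-≤ᵇ-no : ∀ {A : Set} {m n} {x y : A} → n < m → (if m ≤ᵇ n then x else y) ≡ y
if-≤ᵇ-no {m = m} {n} n<m with m ≤ᵇ n | ≤ᵇ⇒≤ m n
... | false | _ = refl
... | true  | m≤n = ⊥-elim (<⇒≱ n<m (m≤n tt))

if-<ᵇ-yes : ∀ {A : Set} {m n} {x y : A} → m < n → (if m <ᵇ n then x else y) ≡ x
if-<ᵇ-yes {m = m} {n} m<n with m <ᵇ n | <⇒<ᵇ m<n
... | true | _ = refl

if-<ᵇ-no : ∀ {A : Set} {m n} {x y : A} → n ≤ m → (if m <ᵇ n then x else y) ≡ y
if-<ᵇ-no {m = m} {n} n≤m with m <ᵇ n | <ᵇ⇒< m n
... | false | _ = refl
... | true  | m<n = ⊥-elim (<⇒≱ (m<n tt) n≤m)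

ones-++ : ∀ u v → ones (u ++ v) ≡ ones u + ones v
ones-++ []          v = refl
ones-++ (true ∷ u)  v = cong suc (ones-++ u v)
ones-++ (false ∷ u) v = ones-++ u v

ones≤length : ∀ w → ones w ≤ length w
ones≤length []          = z≤n
ones≤length (true ∷ w)  = s≤s (ones≤length w)
ones≤length (false ∷ w) = m≤n⇒m≤1+n (ones≤length w)

ones-replicate-true : ∀ a → ones (replicate a true) ≡ a
ones-replicate-true zero    = refl
ones-replicate-true (suc a) = cong suc (ones-replicate-true a)

ones-replicate-false : ∀ a → ones (replicate a false) ≡ 0
ones-replicate-false zero    = refl
ones-replicate-false (suc a) = ones-replicate-false a

ones≡length⇒all-true : ∀ w → ones w ≡ length w → w ≡ replicate (length w) true
ones≡length⇒all-true []          _  = refl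
ones≡length⇒all-true (true ∷ w)  eq = cong (true ∷_) (ones≡length⇒all-true w (suc-injective eq))
ones≡length⇒all-true (false ∷ w) eq = ⊥-elim (<-irrefl eq (s≤s (ones≤length w)))

ones≡0⇒all-false : ∀ w → ones w ≡ 0 → w ≡ replicate (length w) false
ones≡0⇒all-false []          _  = refl
ones≡0⇒all-false (false ∷ w) eq = cong (false ∷_) (ones≡0⇒all-false w eq)

last-one : ∀ w → 1 ≤ ones w → Σ Word λ u → Σ ℕ λ z → w ≡ u ++ true ∷ replicate z false
last-one (true ∷ w) _ with ones w in eq
... | zero  = [] , length w , cong (true ∷_) (ones≡0⇒all-false w eq)
... | suc _ = let u , z , e = last-one w (subst (1 ≤_) (sym eq) (s≤s z≤n))
              in true ∷ u , z , cong (true ∷_) e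
last-one (false ∷ w) 1≤ = let u , z , e = last-one w 1≤ in false ∷ u , z , cong (false ∷_) e

drop-++ : ∀ (u : Word) k v → drop (length u + k) (u ++ v) ≡ drop k v
drop-++ []      k v = refl
drop-++ (_ ∷ u) k v = drop-++ u k v

drop-inside-replicate-false : ∀ k z v → k < z → Σ Word λ r → drop k (replicate z false ++ v) ≡ false ∷ r
drop-inside-replicate-false zero    (suc z) v _         = replicate z false ++ v , refl
drop-inside-replicate-false (suc k) (suc z) v (s≤s k<z) = drop-inside-replicate-false k z v k<z

P-[] : ∀ k → P [] k ≡ 0
P-[] zero    = refl
P-[] (suc k) = refl

P-++ : ∀ u v k → P (u ++ v) k ≡ P u k + P v (k ∸ length u)
P-++ []          v k rewrite P-[] k = refl
P-++ (_ ∷ u)     v zero    = refl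
P-++ (true ∷ u)  v (suc k) = cong suc (P-++ u v k)
P-++ (false ∷ u) v (suc k) = P-++ u v k

P-replicate-true-++ : ∀ a v k → P (replicate a true ++ v) k ≡ k ⊓ a + P v (k ∸ a)
P-replicate-true-++ zero    v k rewrite ⊓-zeroʳ k = refl
P-replicate-true-++ (suc a) v zero    = refl
P-replicate-true-++ (suc a) v (suc k) = cong suc (P-replicate-true-++ a v k)

P-replicate-false-++ : ∀ a v k → P (replicate a false ++ v) k ≡ P v (k ∸ a)
P-replicate-false-++ zero    v k       = refl
P-replicate-false-++ (suc a) v zero    = refl
P-replicate-false-++ (suc a) v (suc k) = P-replicate-false-++ a v k

P≤ : ∀ w k → P w k ≤ k
P≤ []          k rewrite P-[] k = z≤n
P≤ (_ ∷ w)     zero    = z≤n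
P≤ (true ∷ w)  (suc k) = s≤s (P≤ w k)
P≤ (false ∷ w) (suc k) = m≤n⇒m≤1+n (P≤ w k)

P-+ : ∀ w k j → P w (k + j) ≤ P w k + j
P-+ w           zero    j = P≤ w j
P-+ []          (suc k) j = z≤n
P-+ (true ∷ w)  (suc k) j = s≤s (P-+ w k j)
P-+ (false ∷ w) (suc k) j = P-+ w k j

P-mono : ∀ w {k k′} → k ≤ k′ → P w k ≤ P w k′
P-mono []          {k} _ rewrite P-[] k = z≤n
P-mono (_ ∷ w)     z≤n       = z≤n
P-mono (true ∷ w)  (s≤s k≤k′) = s≤s (P-mono w k≤k′)
P-mono (false ∷ w) (s≤s k≤k′) = P-mono w k≤k′

P≤ones : ∀ w k → P w k ≤ ones w
P≤ones []          k rewrite P-[] k = z≤n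
P≤ones (_ ∷ w)     zero    = z≤n
P≤ones (true ∷ w)  (suc k) = s≤s (P≤ones w k)
P≤ones (false ∷ w) (suc k) = P≤ones w k

P-beyond-length : ∀ w k → length w ≤ k → P w k ≡ ones w
P-beyond-length []          k       _         = P-[] k
P-beyond-length (true ∷ w)  (suc k) (s≤s le) = cong suc (P-beyond-length w k le)
P-beyond-length (false ∷ w) (suc k) (s≤s le) = P-beyond-length w k le

P-length : ∀ w → P w (length w) ≡ ones w
P-length w = P-beyond-length w (length w) ≤-refl

P-+-factor : ∀ w j i → P w (j + i) ≡ P w j + ones (factor w j i)
P-+-factor w           zero    i       = refl
P-+-factor []          (suc j) zero    = refl
P-+-factor []          (suc j) (suc i) = refl
P-+-factor (true ∷ w)  (suc j) i       = cong suc (P-+-factor w j i)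
P-+-factor (false ∷ w) (suc j) i       = P-+-factor w j i

SubadditiveUpTo : ℕ → (ℕ → ℕ) → Set
SubadditiveUpTo n f = ∀ i j → j + i ≤ n → f (j + i) ≤ f j + f i

-- Writing each factor as a difference of two prefixes, prefix normality only mentions prefixes.
Subadditive : Word → Set
Subadditive w = SubadditiveUpTo (length w) (P w)

prefixNormal⇒subadditive : ∀ w → PrefixNormal w → Subadditive w
prefixNormal⇒subadditive w pn i j le = begin
  P w (j + i)                 ≡⟨ P-+-factor w j i ⟩
  P w j + ones (factor w j i) ≤⟨ +-monoʳ-≤ (P w j) (pn i j le) ⟩
  P w j + P w i               ∎
  where open ≤-Reasoning

subadditive⇒prefixNormal : ∀ w → Subadditive w → PrefixNormal w
subadditive⇒prefixNormal w sub i j le =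
  +-cancelˡ-≤ (P w j) _ _ (subst (_≤ P w j + P w i) (P-+-factor w j i) (sub i j le))

-- The arrays of info are P(γ,·) and F(γ,·); F is pinned down, for lengths up to |γ|, as the least
-- bound on the ones of the factors of that length, each written as a difference of prefix counts.
record Tabulates (info : GInfo) : Set where
  field
    g≡length    : g info ≡ length (γ info)
    Pg≡P        : ∀ k → Pg info k ≡ P (γ info) k
    Fg-bounds   : ∀ ℓ j → j + ℓ ≤ g info → P (γ info) (j + ℓ) ≤ P (γ info) j + Fg info ℓ
    Fg-attained : ∀ ℓ → ℓ ≤ g info →
                  Σ ℕ λ j → j + ℓ ≤ g info × Fg info ℓ + P (γ info) j ≤ P (γ info) (j + ℓ)
open Tabulates

emptyInfo-tabulates : Tabulates emptyInfo
emptyInfo-tabulates = record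
  { g≡length    = refl
  ; Pg≡P        = λ k → sym (P-[] k)
  ; Fg-bounds   = λ ℓ j _ → subst (_≤ P [] j + 0) (sym (P-[] (j + ℓ))) z≤n
  ; Fg-attained = λ { zero _ → 0 , z≤n , z≤n ; (suc ℓ) () }
  }

P≤P-whole : ∀ {info} → Tabulates info → ∀ k → P (γ info) k ≤ P (γ info) (g info)
P≤P-whole {info} tab k = subst (P (γ info) k ≤_)
  (sym (trans (cong (P (γ info)) (g≡length tab)) (P-length (γ info)))) (P≤ones (γ info) k)

module Extend (z : ℕ) (info : GInfo) (tab : Tabulates info) where
  γ₀ = γ info
  g₀ = g info
  γ′ = true ∷ (replicate z false ++ γ₀)

  -- F(0^z γ, ℓ), as it occurs in the definition of extend
  F-tail : ℕ → ℕ
  F-tail ℓ = if ℓ ≤ᵇ g₀ then Fg info ℓ else Pg info g₀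

  F-tail-short : ∀ {ℓ} → ℓ ≤ g₀ → F-tail ℓ ≡ Fg info ℓ
  F-tail-short = if-≤ᵇ-yes

  F-tail-long : ∀ {ℓ} → g₀ < ℓ → F-tail ℓ ≡ P γ₀ g₀
  F-tail-long lt = trans (if-≤ᵇ-no lt) (Pg≡P tab g₀)

  F-tail-bounds : ∀ j ℓ → j + ℓ ≤ z + g₀ →
    P (replicate z false ++ γ₀) (j + ℓ) ≤ P (replicate z false ++ γ₀) j + F-tail ℓ
  F-tail-bounds j ℓ le with ℓ ≤? g₀
  ... | no ℓ≰g rewrite F-tail-long (≰⇒> ℓ≰g) | P-replicate-false-++ z γ₀ (j + ℓ) =
    ≤-trans (P≤P-whole tab ((j + ℓ) ∸ z)) (m≤n+m _ _)
  ... | yes ℓ≤g rewrite F-tail-short ℓ≤g | P-replicate-false-++ z γ₀ (j + ℓ)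
                      | P-replicate-false-++ z γ₀ j with z ≤? j
  ...   | no z≰j = ≤-trans (≤-trans (P-mono γ₀ shorter) (Fg-bounds tab ℓ 0 ℓ≤g)) (m≤n+m _ _)
    where
    shorter : (j + ℓ) ∸ z ≤ ℓ
    shorter = subst ((j + ℓ) ∸ z ≤_) (m+n∸m≡n z ℓ)
                (∸-monoˡ-≤ z (+-monoˡ-≤ ℓ (<⇒≤ (≰⇒> z≰j))))
  ...   | yes z≤j with ≤-offset z≤j
  ...     | d , refl rewrite +-assoc z d ℓ | m+n∸m≡n z (d + ℓ) | m+n∸m≡n z d =
    Fg-bounds tab ℓ d (+-cancelˡ-≤ z _ _ le)

  P-head : ℕ → ℕ
  P-head ℓ′ = suc (Pg info (ℓ′ ∸ z))

  Pγ′-suc : ∀ ℓ′ → P γ′ (suc ℓ′) ≡ P-head ℓ′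
  Pγ′-suc ℓ′ = cong suc (trans (P-replicate-false-++ z γ₀ ℓ′) (sym (Pg≡P tab (ℓ′ ∸ z))))

  Pγ′-past-zeros : ∀ j → P γ′ (suc (z + j)) ≡ suc (P γ₀ j)
  Pγ′-past-zeros j = cong suc (trans (P-replicate-false-++ z γ₀ (z + j)) (cong (P γ₀) (m+n∸m≡n z j)))

  Pγ′-within-zeros : ∀ k → k ≤ z → P γ′ k ≤ 1
  Pγ′-within-zeros zero    _ = z≤n
  Pγ′-within-zeros (suc k) le
    rewrite P-replicate-false-++ z γ₀ k | m≤n⇒m∸n≡0 (<⇒≤ le) = ≤-refl

  length-γ′ : suc (z + g₀) ≡ length γ′
  length-γ′ = cong suc (trans (cong (z +_) (g≡length tab))
    (sym (trans (length-++ (replicate z false)) (cong (_+ length γ₀) (length-replicate z)))))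

  Fg′-bounds : ∀ ℓ j → j + ℓ ≤ suc (z + g₀) → P γ′ (j + ℓ) ≤ P γ′ j + Fg (extend z info) ℓ
  Fg′-bounds zero     j       _ rewrite +-identityʳ j | +-identityʳ (P γ′ j) = ≤-refl
  Fg′-bounds (suc ℓ′) zero    _ =
    ≤-trans (≤-reflexive (Pγ′-suc ℓ′)) (m≤m⊔n (P-head ℓ′) (F-tail (suc ℓ′)))
  Fg′-bounds (suc ℓ′) (suc j) (s≤s le) = s≤s (≤-trans (F-tail-bounds j (suc ℓ′) le)
    (+-monoʳ-≤ _ (m≤n⊔m (P-head ℓ′) (F-tail (suc ℓ′)))))

  Attains : ℕ → ℕ → Set
  Attains ℓ v = Σ ℕ λ j → j + ℓ ≤ suc (z + g₀) × v + P γ′ j ≤ P γ′ (j + ℓ)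

  -- a factor of γ attaining F(γ,ℓ), shifted past the leading 1 0^z
  Fg-attained-in-γ′ : ∀ {ℓ} → ℓ ≤ g₀ → Attains ℓ (Fg info ℓ)
  Fg-attained-in-γ′ {ℓ} ℓ≤g with Fg-attained tab ℓ ℓ≤g
  ... | j , j+ℓ≤g , attains =
    suc (z + j) , s≤s (subst (_≤ z + g₀) (sym (+-assoc z j ℓ)) (+-monoʳ-≤ z j+ℓ≤g)) ,
    (begin
      Fg info ℓ + P γ′ (suc (z + j))   ≡⟨ cong (Fg info ℓ +_) (Pγ′-past-zeros j) ⟩
      Fg info ℓ + suc (P γ₀ j)         ≡⟨ +-suc _ _ ⟩
      suc (Fg info ℓ + P γ₀ j)         ≤⟨ s≤s attains ⟩
      suc (P γ₀ (j + ℓ))               ≡⟨ sym (Pγ′-past-zeros (j + ℓ)) ⟩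
      P γ′ (suc (z + (j + ℓ)))         ≡⟨ cong (λ x → P γ′ (suc x)) (sym (+-assoc z j ℓ)) ⟩
      P γ′ (suc (z + j) + ℓ)           ∎)
    where open ≤-Reasoning

  -- a factor longer than γ contains all of γ: take the suffix of γ′ of that length
  suffix-attains : ∀ {ℓ} → g₀ < ℓ → ℓ ≤ suc (z + g₀) → Attains ℓ (P γ₀ g₀)
  suffix-attains {ℓ} g<ℓ le with ≤-offset le
  ... | k , eq = k , ≤-reflexive k+ℓ≡ ,
    (begin
      P γ₀ g₀ + P γ′ k          ≤⟨ +-monoʳ-≤ _ (Pγ′-within-zeros k k≤z) ⟩
      P γ₀ g₀ + 1              ≡⟨ +-comm _ 1 ⟩
      suc (P γ₀ g₀)            ≡⟨ sym (Pγ′-past-zeros g₀) ⟩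
      P γ′ (suc (z + g₀))      ≡⟨ cong (P γ′) (sym k+ℓ≡) ⟩
      P γ′ (k + ℓ)             ∎)
    where
    open ≤-Reasoning
    k+ℓ≡ : k + ℓ ≡ suc (z + g₀)
    k+ℓ≡ = trans (+-comm k ℓ) (sym eq)
    k≤z : k ≤ z
    k≤z = +-cancelʳ-≤ (suc g₀) k z
            (≤-trans (+-monoʳ-≤ k g<ℓ) (≤-reflexive (trans k+ℓ≡ (sym (+-suc z g₀)))))

  F-tail-attained : ∀ ℓ → ℓ ≤ suc (z + g₀) → Attains ℓ (F-tail ℓ)
  F-tail-attained ℓ le with ℓ ≤? g₀
  ... | yes ℓ≤g rewrite F-tail-short ℓ≤g = Fg-attained-in-γ′ ℓ≤g
  ... | no  ℓ≰g rewrite F-tail-long (≰⇒> ℓ≰g) = suffix-attains (≰⇒> ℓ≰g) le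

  Fg′-attained : ∀ ℓ → ℓ ≤ suc (z + g₀) → Attains ℓ (Fg (extend z info) ℓ)
  Fg′-attained zero     _  = 0 , z≤n , z≤n
  Fg′-attained (suc ℓ′) le with ≤-total (F-tail (suc ℓ′)) (P-head ℓ′)
  ... | inj₁ tail≤head rewrite m≥n⇒m⊔n≡m tail≤head =
    0 , le , subst (_≤ P γ′ (suc ℓ′)) (sym (+-identityʳ _)) (≤-reflexive (sym (Pγ′-suc ℓ′)))
  ... | inj₂ head≤tail rewrite m≤n⇒m⊔n≡n head≤tail = F-tail-attained (suc ℓ′) le

  extend-tabulates : Tabulates (extend z info)
  extend-tabulates = record
    { g≡length    = length-γ′
    ; Pg≡P        = Pg′≡P
    ; Fg-bounds   = Fg′-bounds
    ; Fg-attained = Fg′-attained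
    }
    where
    Pg′≡P : ∀ k → Pg (extend z info) k ≡ P γ′ k
    Pg′≡P zero    = refl
    Pg′≡P (suc k) = cong suc (trans (Pg≡P tab (k ∸ z)) (sym (P-replicate-false-++ z γ₀ k)))

checkLoop-steps≤ : ∀ k ℓ c → proj₂ (checkLoop k ℓ c) ≤ k
checkLoop-steps≤ zero    ℓ c = z≤n
checkLoop-steps≤ (suc k) ℓ c with c ℓ
... | true  = s≤s (checkLoop-steps≤ k (suc ℓ) c)
... | false = s≤s z≤n

checkLoop-true : ∀ k ℓ c → proj₁ (checkLoop k ℓ c) ≡ true → ∀ x → ℓ ≤ x → x < ℓ + k → T (c x)
checkLoop-true zero ℓ c _ x ℓ≤x x<ℓ+0 = ⊥-elim (<⇒≱ x<ℓ+0 (≤-trans (≤-reflexive (+-identityʳ ℓ)) ℓ≤x))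
checkLoop-true (suc k) ℓ c ok x ℓ≤x x<ℓ+k with c ℓ in cℓ
checkLoop-true (suc k) ℓ c ok x ℓ≤x x<ℓ+k | true with ℓ ≟ x
... | yes refl = subst T (sym cℓ) tt
... | no ℓ≢x = checkLoop-true k (suc ℓ) c ok x (≤∧≢⇒< ℓ≤x ℓ≢x) (subst (x <_) (+-suc ℓ k) x<ℓ+k)
checkLoop-true (suc k) ℓ c () x ℓ≤x x<ℓ+k | false

checkLoop-false : ∀ k ℓ c → proj₁ (checkLoop k ℓ c) ≡ false →
  Σ ℕ λ x → ℓ ≤ x × x < ℓ + k × ¬ T (c x)
checkLoop-false zero    ℓ c ()
checkLoop-false (suc k) ℓ c fails with c ℓ in cℓ
... | false = ℓ , ≤-refl , m<m+n ℓ (s≤s z≤n) , subst T cℓ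
... | true with checkLoop-false k (suc ℓ) c fails
...   | x , ℓ<x , x<ℓ+k , ¬cx = x , <⇒≤ ℓ<x , subst (x <_) (sym (+-suc ℓ k)) x<ℓ+k , ¬cx

m≡n+o⇒m∸n≡o : ∀ {m} n {o} → m ≡ n + o → m ∸ n ≡ o
m≡n+o⇒m∸n≡o n {o} refl = m+n∸m≡n n o

-- The local definitions of childTest, which cannot be named from outside it; they agree with
-- them definitionally.  For the child w = 1^(s-1) 0^i 1 0^z γ of length n, pre ℓ is P(w,ℓ) and
-- candB, candC, candD bound the factors of length ℓ starting at the moved 1, lying inside γ,
-- and ending at the end of w.
module ChildTestTables (s t i : ℕ) (info : GInfo) where
  z  = t ∸ i
  m  = s + t
  gg = g info
  n  = m + gg
  o  = Pg info gg
  pre : ℕ → ℕ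
  pre ℓ = if ℓ ≤ᵇ s ∸ 1 then ℓ
          else if ℓ <ᵇ s + i then s ∸ 1
          else if ℓ ≤ᵇ m then s
          else s + Pg info (ℓ ∸ m)
  candB : ℕ → ℕ
  candB ℓ = if s + i ∸ 1 + ℓ ≤ᵇ n then suc (Pg info ((ℓ ∸ 1) ∸ z)) else 0
  candC : ℕ → ℕ
  candC ℓ = if ℓ ≤ᵇ gg then Fg info ℓ else 0
  sufU : ℕ → ℕ
  sufU r = if r ≤ᵇ z then 0
           else if r ≤ᵇ suc (z + i) then 1
           else suc (r ∸ suc (z + i))
  candD : ℕ → ℕ
  candD ℓ = if ℓ ≤ᵇ gg then 0 else o + sufU (ℓ ∸ gg)
  cond : ℕ → Bool
  cond ℓ = (candB ℓ ≤ᵇ pre ℓ) ∧ ((candC ℓ ≤ᵇ pre ℓ) ∧ (candD ℓ ≤ᵇ pre ℓ))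

module ChildTest (s′ t i : ℕ) (info : GInfo) (tab : Tabulates info) (i≤t : i ≤ t) where
  open ChildTestTables (suc s′) t i info

  i+z≡t : i + z ≡ t
  i+z≡t = m+[n∸m]≡n i≤t

  γ₀ = γ info
  g₀ = g info
  Pγ = P γ₀
  γ′ = γ (extend z info)
  w  = node s′ i (extend z info)
  Pw = P w

  Pw-shape : ∀ k → Pw k ≡ k ⊓ s′ + P γ′ ((k ∸ s′) ∸ i)
  Pw-shape k = trans (P-replicate-true-++ s′ _ k) (cong (k ⊓ s′ +_) (P-replicate-false-++ i γ′ (k ∸ s′)))

  Pw-in-ones : ∀ {k} → k ≤ s′ → Pw k ≡ k
  Pw-in-ones {k} le rewrite Pw-shape k | m≤n⇒m⊓n≡m le | m≤n⇒m∸n≡0 le | 0∸n≡0 i = +-identityʳ k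

  Pw-in-zeros : ∀ {k} → s′ ≤ k → k ≤ s′ + i → Pw k ≡ s′
  Pw-in-zeros {k} le1 le2 rewrite Pw-shape k | m≥n⇒m⊓n≡n le1 =
    trans (cong (λ q → s′ + P γ′ q) inside) (+-identityʳ s′)
    where inside : (k ∸ s′) ∸ i ≡ 0
          inside = m≤n⇒m∸n≡0 (subst (k ∸ s′ ≤_) (m+n∸m≡n s′ i) (∸-monoˡ-≤ s′ le2))

  Pw-past-moved-one : ∀ k → Pw (suc s′ + i + k) ≡ suc s′ + Pγ (k ∸ z)
  Pw-past-moved-one k rewrite sym (+-suc (s′ + i) k) | Pw-shape (s′ + i + suc k)
    | m≥n⇒m⊓n≡n (≤-trans (m≤m+n s′ i) (m≤m+n (s′ + i) (suc k)))
    | +-assoc s′ i (suc k) | m+n∸m≡n s′ (i + suc k) | m+n∸m≡n i (suc k)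
    | P-replicate-false-++ z γ₀ k = +-suc s′ _

  m≡ : m ≡ suc s′ + i + z
  m≡ = trans (cong (suc s′ +_) (sym i+z≡t)) (sym (+-assoc (suc s′) i z))

  Pw-in-γ : ∀ x → Pw (m + x) ≡ suc s′ + Pγ x
  Pw-in-γ x = trans (cong Pw (trans (cong (λ q → suc s′ + q + x) (sym i+z≡t)) (regroup s′ i z x)))
    (trans (Pw-past-moved-one (z + x)) (cong (λ q → suc s′ + Pγ q) (m+n∸m≡n z x)))
    where regroup : ∀ s i z x → suc s + (i + z) + x ≡ suc s + i + (z + x)
          regroup = solve-∀

  Pw-m : Pw m ≡ suc s′
  Pw-m = trans (cong Pw (sym (+-identityʳ m))) (trans (Pw-in-γ 0) (+-identityʳ (suc s′)))

  Pw-n : Pw n ≡ suc s′ + Pγ g₀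
  Pw-n = Pw-in-γ g₀

  Pw≤ : ∀ {x} → x ≤ m → Pw x ≤ suc s′
  Pw≤ le = ≤-trans (P-mono w le) (≤-reflexive Pw-m)

  length-w : length w ≡ n
  length-w = begin
    length (replicate s′ true ++ (replicate i false ++ γ′))
      ≡⟨ length-++ (replicate s′ true) ⟩
    length (replicate s′ true) + length (replicate i false ++ γ′)
      ≡⟨ cong₂ _+_ (length-replicate s′) (length-++ (replicate i false)) ⟩
    s′ + (length (replicate i false) + suc (length (replicate z false ++ γ₀)))
      ≡⟨ cong₂ (λ a b → s′ + (a + suc b)) (length-replicate i) (length-++ (replicate z false)) ⟩
    s′ + (i + suc (length (replicate z false) + length γ₀))
      ≡⟨ cong₂ (λ a b → s′ + (i + suc (a + b))) (length-replicate z) (sym (g≡length tab)) ⟩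
    s′ + (i + suc (z + g₀))
      ≡⟨ regroup s′ i z g₀ ⟩
    suc s′ + (i + z) + g₀
      ≡⟨ cong (λ q → suc s′ + q + g₀) i+z≡t ⟩
    n ∎
    where open ≡-Reasoning
          regroup : ∀ s i z g → s + (i + suc (z + g)) ≡ suc s + (i + z) + g
          regroup = solve-∀

  pre-past-moved-one : ∀ k → pre (suc s′ + i + k) ≡ Pw (suc s′ + i + k)
  pre-past-moved-one k with k ≤? z
  ... | yes k≤z = begin
    pre ℓ                     ≡⟨ if-≤ᵇ-no s′<ℓ ⟩
    (if ℓ <ᵇ suc s′ + i then s′ else if ℓ ≤ᵇ m then suc s′ else suc s′ + Pg info (ℓ ∸ m))
                              ≡⟨ if-<ᵇ-no (m≤m+n (suc s′ + i) k) ⟩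
    (if ℓ ≤ᵇ m then suc s′ else suc s′ + Pg info (ℓ ∸ m))
                              ≡⟨ if-≤ᵇ-yes ℓ≤m ⟩
    suc s′                    ≡⟨ sym (+-identityʳ _) ⟩
    suc s′ + Pγ 0             ≡⟨ cong (λ q → suc s′ + Pγ q) (sym (m≤n⇒m∸n≡0 k≤z)) ⟩
    suc s′ + Pγ (k ∸ z)       ≡⟨ sym (Pw-past-moved-one k) ⟩
    Pw ℓ                      ∎
    where
    open ≡-Reasoning
    ℓ = suc s′ + i + k
    s′<ℓ : s′ < ℓ
    s′<ℓ = s≤s (≤-trans (m≤m+n s′ i) (m≤m+n (s′ + i) k))
    ℓ≤m : ℓ ≤ m
    ℓ≤m = subst (ℓ ≤_) (sym m≡) (+-monoʳ-≤ (suc s′ + i) k≤z)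
  ... | no k≰z = begin
    pre ℓ                     ≡⟨ if-≤ᵇ-no s′<ℓ ⟩
    (if ℓ <ᵇ suc s′ + i then s′ else if ℓ ≤ᵇ m then suc s′ else suc s′ + Pg info (ℓ ∸ m))
                              ≡⟨ if-<ᵇ-no (m≤m+n (suc s′ + i) k) ⟩
    (if ℓ ≤ᵇ m then suc s′ else suc s′ + Pg info (ℓ ∸ m))
                              ≡⟨ if-≤ᵇ-no m<ℓ ⟩
    suc s′ + Pg info (ℓ ∸ m)  ≡⟨ cong (suc s′ +_) (Pg≡P tab (ℓ ∸ m)) ⟩
    suc s′ + Pγ (ℓ ∸ m)       ≡⟨ cong (λ q → suc s′ + Pγ q) ℓ∸m ⟩
    suc s′ + Pγ (k ∸ z)       ≡⟨ sym (Pw-past-moved-one k) ⟩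
    Pw ℓ                      ∎
    where
    open ≡-Reasoning
    ℓ = suc s′ + i + k
    s′<ℓ : s′ < ℓ
    s′<ℓ = s≤s (≤-trans (m≤m+n s′ i) (m≤m+n (s′ + i) k))
    m<ℓ : m < ℓ
    m<ℓ = subst (_< ℓ) (sym m≡) (+-monoʳ-< (suc s′ + i) (≰⇒> k≰z))
    ℓ∸m : ℓ ∸ m ≡ k ∸ z
    ℓ∸m = trans (cong (ℓ ∸_) m≡) ([m+n]∸[m+o]≡n∸o (suc s′ + i) k z)

  pre≡Pw : ∀ ℓ → pre ℓ ≡ Pw ℓ
  pre≡Pw ℓ with ℓ ≤? s′
  ... | yes ℓ≤s′ = trans (if-≤ᵇ-yes ℓ≤s′) (sym (Pw-in-ones ℓ≤s′))
  ... | no ℓ≰s′ with ℓ <? suc s′ + i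
  ...   | yes ℓ<s+i = trans (if-≤ᵇ-no (≰⇒> ℓ≰s′)) (trans (if-<ᵇ-yes ℓ<s+i)
                        (sym (Pw-in-zeros (<⇒≤ (≰⇒> ℓ≰s′)) (≤-pred ℓ<s+i))))
  ...   | no ℓ≮s+i with ≤-offset (≮⇒≥ ℓ≮s+i)
  ...     | k , refl = pre-past-moved-one k

  BoundAtMovedOne BoundInγ BoundOnSuffix Bounds : ℕ → Set
  BoundAtMovedOne ℓ = s′ + i + ℓ ≤ n → Pw (s′ + i + ℓ) ≤ Pw (s′ + i) + Pw ℓ
  BoundInγ        ℓ = ℓ ≤ g₀ → Fg info ℓ ≤ Pw ℓ
  BoundOnSuffix   ℓ = g₀ < ℓ → ℓ ≤ n → Pw n ≤ Pw (n ∸ ℓ) + Pw ℓ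
  Bounds          ℓ = BoundAtMovedOne ℓ × BoundInγ ℓ × BoundOnSuffix ℓ

  Pw-moved-one : Pw (s′ + i) ≡ s′
  Pw-moved-one = Pw-in-zeros (m≤m+n s′ i) ≤-refl

  Pw-from-moved-one : ∀ ℓ′ → Pw (s′ + i + suc ℓ′) ≡ s′ + suc (Pγ (ℓ′ ∸ z))
  Pw-from-moved-one ℓ′ =
    trans (cong Pw (+-suc (s′ + i) ℓ′)) (trans (Pw-past-moved-one ℓ′) (sym (+-suc s′ _)))

  candB-sound : ∀ ℓ → 1 ≤ ℓ → candB ℓ ≤ Pw ℓ → BoundAtMovedOne ℓ
  candB-sound (suc ℓ′) _ cb fits
    rewrite if-≤ᵇ-yes {x = suc (Pg info (ℓ′ ∸ z))} {y = 0} fits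
          | Pw-from-moved-one ℓ′ | Pw-moved-one | Pg≡P tab (ℓ′ ∸ z) = +-monoʳ-≤ s′ cb

  candB-complete : ∀ ℓ → 1 ≤ ℓ → BoundAtMovedOne ℓ → candB ℓ ≤ Pw ℓ
  candB-complete (suc ℓ′) _ bound with s′ + i + suc ℓ′ ≤? n
  ... | yes fits rewrite if-≤ᵇ-yes {x = suc (Pg info (ℓ′ ∸ z))} {y = 0} fits | Pg≡P tab (ℓ′ ∸ z) =
    +-cancelˡ-≤ s′ _ _
      (subst₂ _≤_ (Pw-from-moved-one ℓ′) (cong (_+ Pw (suc ℓ′)) Pw-moved-one) (bound fits))
  ... | no ¬fits rewrite if-≤ᵇ-no {x = suc (Pg info (ℓ′ ∸ z))} {y = 0} (≰⇒> ¬fits) = z≤n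

  candC-sound : ∀ ℓ → candC ℓ ≤ Pw ℓ → BoundInγ ℓ
  candC-sound ℓ cc ℓ≤g rewrite if-≤ᵇ-yes {x = Fg info ℓ} {y = 0} ℓ≤g = cc

  candC-complete : ∀ ℓ → BoundInγ ℓ → candC ℓ ≤ Pw ℓ
  candC-complete ℓ bound with ℓ ≤? g₀
  ... | yes ℓ≤g rewrite if-≤ᵇ-yes {x = Fg info ℓ} {y = 0} ℓ≤g = bound ℓ≤g
  ... | no ℓ≰g rewrite if-≤ᵇ-no {x = Fg info ℓ} {y = 0} (≰⇒> ℓ≰g) = z≤n

  -- sufU r counts the ones in the length-r suffix of 1^s′ 0^i 1 0^z.
  suffix-in-zeros : ∀ {r} → r ≤ z → Pw (m ∸ r) + sufU r ≡ suc s′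
  suffix-in-zeros {r} r≤z with ≤-offset r≤z
  ... | e , z≡r+e = begin
    Pw (m ∸ r) + sufU r          ≡⟨ cong₂ _+_ (cong Pw m∸r) (if-≤ᵇ-yes r≤z) ⟩
    Pw (suc s′ + i + e) + 0      ≡⟨ +-identityʳ _ ⟩
    Pw (suc s′ + i + e)          ≡⟨ Pw-past-moved-one e ⟩
    suc s′ + Pγ (e ∸ z)          ≡⟨ cong (λ q → suc s′ + Pγ q) e∸z ⟩
    suc s′ + 0                   ≡⟨ +-identityʳ _ ⟩
    suc s′                       ∎
    where
    open ≡-Reasoning
    regroup : ∀ s i r e → suc s + i + (r + e) ≡ r + (suc s + i + e)
    regroup = solve-∀
    m∸r : m ∸ r ≡ suc s′ + i + e
    m∸r = m≡n+o⇒m∸n≡o r (trans m≡ (trans (cong (suc s′ + i +_) z≡r+e) (regroup s′ i r e)))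
    e∸z : e ∸ z ≡ 0
    e∸z = m≤n⇒m∸n≡0 (subst (e ≤_) (sym z≡r+e) (m≤n+m e r))

  suffix-with-moved-one : ∀ {r} → z < r → r ≤ suc (z + i) → Pw (m ∸ r) + sufU r ≡ suc s′
  suffix-with-moved-one {r} z<r r≤ with ≤-offset z<r
  ... | e , r≡ with ≤-offset (+-cancelˡ-≤ (suc z) e i (subst (_≤ suc z + i) r≡ r≤))
  ...   | f , i≡e+f = begin
    Pw (m ∸ r) + sufU r          ≡⟨ cong₂ _+_ (cong Pw m∸r) (if-≤ᵇ-no z<r) ⟩
    Pw (s′ + f) + (if r ≤ᵇ suc (z + i) then 1 else suc (r ∸ suc (z + i)))
                                 ≡⟨ cong₂ _+_ (Pw-in-zeros (m≤m+n s′ f) (+-monoʳ-≤ s′ f≤i)) (if-≤ᵇ-yes r≤) ⟩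
    s′ + 1                       ≡⟨ +-comm s′ 1 ⟩
    suc s′                       ∎
    where
    open ≡-Reasoning
    f≤i : f ≤ i
    f≤i = subst (f ≤_) (sym i≡e+f) (m≤n+m f e)
    regroup : ∀ s e f z → suc s + (e + f) + z ≡ (suc z + e) + (s + f)
    regroup = solve-∀
    m∸r : m ∸ r ≡ s′ + f
    m∸r = m≡n+o⇒m∸n≡o r (trans m≡ (trans (cong (λ q → suc s′ + q + z) i≡e+f)
            (trans (regroup s′ e f z) (cong (_+ (s′ + f)) (sym r≡)))))

  suffix-into-ones : ∀ {r} → suc (z + i) < r → r ≤ m → Pw (m ∸ r) + sufU r ≡ suc s′
  suffix-into-ones {r} long r≤m with ≤-offset long
  ... | d , r≡ with ≤-offset d<s′
    where
    d<s′ : suc d ≤ s′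
    d<s′ = +-cancelʳ-≤ (suc (i + z)) (suc d) s′
      (subst₂ _≤_ (regroupˡ z i d) (regroupʳ s′ i z) (subst (_≤ suc s′ + i + z) r≡ (subst (r ≤_) m≡ r≤m)))
      where regroupˡ : ∀ z i d → suc (suc (z + i)) + d ≡ suc d + suc (i + z)
            regroupˡ = solve-∀
            regroupʳ : ∀ s i z → suc s + i + z ≡ s + suc (i + z)
            regroupʳ = solve-∀
  ... | e , s′≡ = begin
    Pw (m ∸ r) + sufU r          ≡⟨ cong₂ _+_ (cong Pw m∸r) (if-≤ᵇ-no (<-trans (s≤s (m≤m+n z i)) long)) ⟩
    Pw e + (if r ≤ᵇ suc (z + i) then 1 else suc (r ∸ suc (z + i)))
                                 ≡⟨ cong₂ _+_ (Pw-in-ones e≤s′) (if-≤ᵇ-no long) ⟩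
    e + suc (r ∸ suc (z + i))    ≡⟨ cong (λ q → e + suc q) (m≡n+o⇒m∸n≡o (suc (z + i)) (trans r≡ (sym (+-suc _ d)))) ⟩
    e + suc (suc d)              ≡⟨ +-comm e _ ⟩
    suc (suc d + e)              ≡⟨ cong suc (sym s′≡) ⟩
    suc s′                       ∎
    where
    open ≡-Reasoning
    e≤s′ : e ≤ s′
    e≤s′ = subst (e ≤_) (sym s′≡) (m≤n+m e (suc d))
    regroup : ∀ s i z e d → suc (suc d + e) + i + z ≡ (suc (suc (z + i)) + d) + e
    regroup = solve-∀
    m∸r : m ∸ r ≡ e
    m∸r = m≡n+o⇒m∸n≡o r (trans m≡ (trans (cong (λ q → suc q + i + z) s′≡)
            (trans (regroup s′ i z e d) (cong (_+ e) (sym r≡)))))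

  suffix-split : ∀ r → r ≤ m → Pw (m ∸ r) + sufU r ≡ suc s′
  suffix-split r r≤m with r ≤? z
  ... | yes r≤z = suffix-in-zeros r≤z
  ... | no r≰z with r ≤? suc (z + i)
  ...   | yes r≤ = suffix-with-moved-one (≰⇒> r≰z) r≤
  ...   | no r≰  = suffix-into-ones (≰⇒> r≰) r≤m

  module LongSuffix {ℓ} (g<ℓ : g₀ < ℓ) (ℓ≤n : ℓ ≤ n) where
    r = ℓ ∸ g₀

    ℓ≡ : ℓ ≡ g₀ + r
    ℓ≡ = sym (m+[n∸m]≡n (<⇒≤ g<ℓ))

    r≤m : r ≤ m
    r≤m = +-cancelʳ-≤ g₀ r m (subst (_≤ m + g₀) (trans ℓ≡ (+-comm g₀ r)) ℓ≤n)

    n∸ℓ : n ∸ ℓ ≡ m ∸ r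
    n∸ℓ = trans (cong₂ _∸_ (+-comm m g₀) ℓ≡) ([m+n]∸[m+o]≡n∸o g₀ m r)

    candD≡ : candD ℓ ≡ o + sufU r
    candD≡ = if-≤ᵇ-no g<ℓ

    Pw-n-split : Pw n ≡ Pw (n ∸ ℓ) + (o + sufU r)
    Pw-n-split = begin
      Pw n                         ≡⟨ Pw-n ⟩
      suc s′ + Pγ g₀               ≡⟨ cong (_+ Pγ g₀) (sym (suffix-split r r≤m)) ⟩
      Pw (m ∸ r) + sufU r + Pγ g₀  ≡⟨ +-assoc (Pw (m ∸ r)) _ _ ⟩
      Pw (m ∸ r) + (sufU r + Pγ g₀)
        ≡⟨ cong₂ (λ a b → Pw a + b) (sym n∸ℓ)
                 (trans (+-comm (sufU r) _) (cong (_+ sufU r) (sym (Pg≡P tab g₀)))) ⟩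
      Pw (n ∸ ℓ) + (o + sufU r)    ∎
      where open ≡-Reasoning

  candD-sound : ∀ ℓ → candD ℓ ≤ Pw ℓ → BoundOnSuffix ℓ
  candD-sound ℓ cd g<ℓ ℓ≤n = subst (_≤ Pw (n ∸ ℓ) + Pw ℓ) (sym Pw-n-split)
    (+-monoʳ-≤ (Pw (n ∸ ℓ)) (subst (_≤ Pw ℓ) candD≡ cd))
    where open LongSuffix g<ℓ ℓ≤n

  candD-complete : ∀ ℓ → ℓ ≤ n → BoundOnSuffix ℓ → candD ℓ ≤ Pw ℓ
  candD-complete ℓ ℓ≤n bound with ℓ ≤? g₀
  ... | yes ℓ≤g rewrite if-≤ᵇ-yes {x = 0} {y = o + sufU (ℓ ∸ g₀)} ℓ≤g = z≤n
  ... | no ℓ≰g = subst (_≤ Pw ℓ) (sym candD≡)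
    (+-cancelˡ-≤ (Pw (n ∸ ℓ)) _ _ (subst (_≤ Pw (n ∸ ℓ) + Pw ℓ) Pw-n-split (bound (≰⇒> ℓ≰g) ℓ≤n)))
    where open LongSuffix (≰⇒> ℓ≰g) ℓ≤n

  cond⇒bounds : ∀ ℓ → 1 ≤ ℓ → T (cond ℓ) → Bounds ℓ
  cond⇒bounds ℓ 1≤ℓ c =
    let tB , tCD = Equivalence.to T-∧ c
        tC , tD  = Equivalence.to T-∧ tCD
    in candB-sound ℓ 1≤ℓ (≤Pw tB) , candC-sound ℓ (≤Pw tC) , candD-sound ℓ (≤Pw tD)
    where ≤Pw : ∀ {x} → T (x ≤ᵇ pre ℓ) → x ≤ Pw ℓ
          ≤Pw t = subst (_ ≤_) (pre≡Pw ℓ) (≤ᵇ⇒≤ _ _ t)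

  bounds⇒cond : ∀ ℓ → 1 ≤ ℓ → ℓ ≤ n → Bounds ℓ → T (cond ℓ)
  bounds⇒cond ℓ 1≤ℓ ℓ≤n (bB , bC , bD) = Equivalence.from T-∧
    (≤ᵇpre (candB-complete ℓ 1≤ℓ bB) ,
     Equivalence.from T-∧ (≤ᵇpre (candC-complete ℓ bC) , ≤ᵇpre (candD-complete ℓ ℓ≤n bD)))
    where ≤ᵇpre : ∀ {x} → x ≤ Pw ℓ → T (x ≤ᵇ pre ℓ)
          ≤ᵇpre le = ≤⇒≤ᵇ (subst (_ ≤_) (sym (pre≡Pw ℓ)) le)

  subadditive⇒bounds : Subadditive w → ∀ ℓ → ℓ ≤ n → Bounds ℓ
  subadditive⇒bounds sub ℓ ℓ≤n = atMovedOne , inγ , onSuffix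
    where
    fits : ∀ {x} → x ≤ n → x ≤ length w
    fits = subst (_ ≤_) (sym length-w)
    atMovedOne : BoundAtMovedOne ℓ
    atMovedOne le = sub ℓ (s′ + i) (fits le)
    inγ : BoundInγ ℓ
    inγ ℓ≤g with Fg-attained tab ℓ ℓ≤g
    ... | j , j+ℓ≤g , attains =
      +-cancelʳ-≤ (Pγ j) _ _ (≤-trans attains (subst (Pγ (j + ℓ) ≤_) (+-comm (Pγ j) (Pw ℓ)) inside))
      where
      inside : Pγ (j + ℓ) ≤ Pγ j + Pw ℓ
      inside = +-cancelˡ-≤ (suc s′) _ _ (subst₂ _≤_
        (trans (cong Pw (+-assoc m j ℓ)) (Pw-in-γ (j + ℓ)))
        (trans (cong (_+ Pw ℓ) (Pw-in-γ j)) (+-assoc (suc s′) _ _))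
        (sub ℓ (m + j) (fits (subst (_≤ n) (sym (+-assoc m j ℓ)) (+-monoʳ-≤ m j+ℓ≤g)))))
    onSuffix : BoundOnSuffix ℓ
    onSuffix _ ℓ≤n′ = subst (λ q → Pw q ≤ Pw (n ∸ ℓ) + Pw ℓ) (m∸n+n≡m ℓ≤n′)
      (sub ℓ (n ∸ ℓ) (fits (≤-reflexive (m∸n+n≡m ℓ≤n′))))

  long-factor-covers-γ : ∀ {ℓ} → g₀ < ℓ → ℓ ≤ n → BoundOnSuffix ℓ → Pγ g₀ ≤ Pw ℓ
  long-factor-covers-γ {ℓ} g<ℓ ℓ≤n onSuffix = +-cancelˡ-≤ (suc s′) _ _ (begin
    suc s′ + Pγ g₀        ≡⟨ sym Pw-n ⟩
    Pw n                  ≤⟨ onSuffix g<ℓ ℓ≤n ⟩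
    Pw (n ∸ ℓ) + Pw ℓ     ≤⟨ +-monoˡ-≤ (Pw ℓ) (Pw≤ n∸ℓ≤m) ⟩
    suc s′ + Pw ℓ         ∎)
    where
    open ≤-Reasoning
    n∸ℓ≤m : n ∸ ℓ ≤ m
    n∸ℓ≤m = ≤-trans (∸-monoʳ-≤ n (<⇒≤ g<ℓ)) (≤-reflexive (m+n∸n≡m m g₀))

  factor-past-moved-one : ∀ k ℓ → suc s′ + i + k + ℓ ≤ n → BoundInγ ℓ → BoundOnSuffix ℓ →
    Pγ ((k + ℓ) ∸ z) ≤ Pγ (k ∸ z) + Pw ℓ
  factor-past-moved-one k ℓ fits inγ onSuffix with z ≤? k
  ... | yes z≤k with ≤-offset z≤k
  ...   | d , refl rewrite +-assoc z d ℓ | m+n∸m≡n z (d + ℓ) | m+n∸m≡n z d =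
    ≤-trans (Fg-bounds tab ℓ d d+ℓ≤g) (+-monoʳ-≤ (Pγ d) (inγ (≤-trans (m≤n+m ℓ d) d+ℓ≤g)))
    where
    regroup : ∀ s i z d ℓ → suc s + i + (z + d) + ℓ ≡ suc s + i + z + (d + ℓ)
    regroup = solve-∀
    d+ℓ≤g : d + ℓ ≤ g₀
    d+ℓ≤g = +-cancelˡ-≤ m _ _
      (subst (_≤ n) (trans (regroup s′ i z d ℓ) (cong (_+ (d + ℓ)) (sym m≡))) fits)
  factor-past-moved-one k ℓ fits inγ onSuffix | no z≰k
    rewrite m≤n⇒m∸n≡0 (<⇒≤ (≰⇒> z≰k)) with ℓ ≤? g₀
  ... | yes ℓ≤g = ≤-trans (P-mono γ₀ shorter) (≤-trans (Fg-bounds tab ℓ 0 ℓ≤g) (inγ ℓ≤g))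
    where
    shorter : (k + ℓ) ∸ z ≤ ℓ
    shorter = subst ((k + ℓ) ∸ z ≤_) (m+n∸m≡n z ℓ) (∸-monoˡ-≤ z (+-monoˡ-≤ ℓ (<⇒≤ (≰⇒> z≰k))))
  ... | no ℓ≰g = ≤-trans (P≤P-whole tab ((k + ℓ) ∸ z))
    (long-factor-covers-γ (≰⇒> ℓ≰g) (≤-trans (m≤n+m ℓ _) fits) onSuffix)

  factor-from-zeros : ∀ {j ℓ} → s′ < j → j ≤ s′ + i → j + ℓ ≤ n → Bounds ℓ → Pw (j + ℓ) ≤ s′ + Pw ℓ
  factor-from-zeros {j} {ℓ} s′<j j≤ fits (atMovedOne , _ , onSuffix) with s′ + i + ℓ ≤? n
  ... | yes fits′ = ≤-trans (P-mono w (+-monoˡ-≤ ℓ j≤))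
    (subst (λ q → Pw (s′ + i + ℓ) ≤ q + Pw ℓ) Pw-moved-one (atMovedOne fits′))
  ... | no ¬fits′ = ≤-trans (P-mono w fits) (≤-trans (onSuffix g<ℓ (≤-trans (m≤n+m ℓ j) fits))
                      (≤-reflexive (cong (_+ Pw ℓ) Pw-n∸ℓ)))
    where
    g<ℓ : g₀ < ℓ
    g<ℓ = ≰⇒> (λ ℓ≤g → ¬fits′ (+-mono-≤ (m≤n⇒m≤1+n (+-monoʳ-≤ s′ i≤t)) ℓ≤g))
    Pw-n∸ℓ : Pw (n ∸ ℓ) ≡ s′
    Pw-n∸ℓ = Pw-in-zeros (≤-trans (<⇒≤ s′<j) (m+n≤o⇒m≤o∸n j fits))
      (subst (n ∸ ℓ ≤_) (m+n∸n≡m (s′ + i) ℓ) (∸-monoˡ-≤ ℓ (<⇒≤ (≰⇒> ¬fits′))))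

  factor-bound : ∀ j ℓ → j + ℓ ≤ n → Bounds ℓ → Pw (j + ℓ) ≤ Pw j + Pw ℓ
  factor-bound j ℓ fits bounds with j ≤? s′
  ... | yes j≤s′ rewrite Pw-in-ones j≤s′ =
    subst₂ _≤_ (cong Pw (+-comm ℓ j)) (+-comm (Pw ℓ) j) (P-+ w ℓ j)
  ... | no j≰s′ with j ≤? s′ + i
  ...   | yes j≤ rewrite Pw-in-zeros (<⇒≤ (≰⇒> j≰s′)) j≤ = factor-from-zeros (≰⇒> j≰s′) j≤ fits bounds
  ...   | no j≰ with ≤-offset (≰⇒> j≰)
  ...     | k , refl = let _ , inγ , onSuffix = bounds in begin
    Pw (suc s′ + i + k + ℓ)            ≡⟨ cong Pw (+-assoc (suc s′ + i) k ℓ) ⟩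
    Pw (suc s′ + i + (k + ℓ))          ≡⟨ Pw-past-moved-one (k + ℓ) ⟩
    suc s′ + Pγ ((k + ℓ) ∸ z)          ≤⟨ +-monoʳ-≤ (suc s′) (factor-past-moved-one k ℓ fits inγ onSuffix) ⟩
    suc s′ + (Pγ (k ∸ z) + Pw ℓ)       ≡⟨ sym (+-assoc (suc s′) _ _) ⟩
    suc s′ + Pγ (k ∸ z) + Pw ℓ         ≡⟨ cong (_+ Pw ℓ) (sym (Pw-past-moved-one k)) ⟩
    Pw (suc s′ + i + k) + Pw ℓ         ∎
    where open ≤-Reasoning

  -- Only three kinds of factor need checking: those starting at the moved 1, those inside γ and the
  -- suffixes; a factor starting in the leading 1s or 0s is dominated by the prefix or by one of these.
  bounds⇒subadditive : (∀ ℓ → 1 ≤ ℓ → ℓ ≤ n → Bounds ℓ) → Subadditive w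
  bounds⇒subadditive _      zero     j _ rewrite +-identityʳ j = m≤m+n (Pw j) 0
  bounds⇒subadditive bounds (suc ℓ′) j fits′ =
    factor-bound j (suc ℓ′) fits (bounds (suc ℓ′) (s≤s z≤n) (≤-trans (m≤n+m (suc ℓ′) j) fits))
    where fits : j + suc ℓ′ ≤ n
          fits = subst (j + suc ℓ′ ≤_) length-w fits′

  childTest-true : proj₁ (childTest (suc s′) t i info) ≡ true → Subadditive w
  childTest-true ok = bounds⇒subadditive λ ℓ 1≤ℓ ℓ≤n →
    cond⇒bounds ℓ 1≤ℓ (checkLoop-true n 1 cond ok ℓ 1≤ℓ (s≤s ℓ≤n))

  childTest-false : proj₁ (childTest (suc s′) t i info) ≡ false → ¬ Subadditive w
  childTest-false fails sub with checkLoop-false n 1 cond fails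
  ... | ℓ , 1≤ℓ , ℓ<1+n , ¬cond =
    ¬cond (bounds⇒cond ℓ 1≤ℓ (≤-pred ℓ<1+n) (subadditive⇒bounds sub ℓ (≤-pred ℓ<1+n)))

subadditive-from-below : ∀ n (f g : ℕ → ℕ) → (∀ k → g k ≤ f k) → SubadditiveUpTo n g →
  (∀ i j → j + i ≤ n → f (j + i) ≤ g (j + i) ⊎ f (j + i) ≤ f j + f i) → SubadditiveUpTo n f
subadditive-from-below n f g g≤f g-sub f-cases i j le with f-cases i j le
... | inj₁ below = ≤-trans below (≤-trans (g-sub i j le) (+-mono-≤ (g≤f j) (g≤f i)))
... | inj₂ sub   = sub

⊓-subadditive : ∀ j i a → (j + i) ⊓ a ≤ j ⊓ a + i ⊓ a
⊓-subadditive j i a with j ≤? a | i ≤? a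
... | no j≰a | _ rewrite m≥n⇒m⊓n≡n (<⇒≤ (≰⇒> j≰a)) = ≤-trans (m⊓n≤n (j + i) a) (m≤m+n a _)
... | yes _ | no i≰a rewrite m≥n⇒m⊓n≡n (<⇒≤ (≰⇒> i≰a)) = ≤-trans (m⊓n≤n (j + i) a) (m≤n+m a _)
... | yes j≤a | yes i≤a rewrite m≤n⇒m⊓n≡m j≤a | m≤n⇒m⊓n≡m i≤a = m⊓n≤m (j + i) a

blocks : ℕ → ℕ → Word → Word
blocks a b γ = replicate a true ++ (replicate b false ++ γ)

length-blocks : ∀ a b γ → length (blocks a b γ) ≡ a + b + length γ
length-blocks a b γ = trans (length-++ (replicate a true))
  (trans (cong₂ _+_ (length-replicate a)
           (trans (length-++ (replicate b false)) (cong (_+ length γ) (length-replicate b))))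
         (sym (+-assoc a b _)))

P-blocks : ∀ a b γ k → P (blocks a b γ) k ≡ k ⊓ a + P γ (k ∸ (a + b))
P-blocks a b γ k = trans (P-replicate-true-++ a _ k)
  (cong (k ⊓ a +_) (trans (P-replicate-false-++ b γ (k ∸ a)) (cong (P γ) (∸-+-assoc k a b))))

blocks-subadditive : ∀ a b γ → SubadditiveUpTo (a + b) (P (blocks a b γ))
blocks-subadditive a b γ i j le
  rewrite P-blocks a b γ (j + i) | P-blocks a b γ j | P-blocks a b γ i
        | m≤n⇒m∸n≡0 le | m≤n⇒m∸n≡0 (≤-trans (m≤m+n j i) le) | m≤n⇒m∸n≡0 (≤-trans (m≤n+m i j) le)
        | +-identityʳ ((j + i) ⊓ a) | +-identityʳ (j ⊓ a) | +-identityʳ (i ⊓ a) = ⊓-subadditive j i a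

blocks-[]-subadditive : ∀ a b → Subadditive (blocks a b [])
blocks-[]-subadditive a b i j le =
  blocks-subadditive a b [] i j (subst (j + i ≤_) (trans (length-blocks a b []) (+-identityʳ _)) le)

-- Moving the 1s of a prefix to its front only raises prefix counts, and up to the end of that prefix
-- the sorted word is subadditive; beyond it both words have the same prefix counts.
sorting-prefix-preserves-subadditive : ∀ a b u γ → length u ≡ a + b → ones u ≡ a →
  Subadditive (u ++ γ) → Subadditive (blocks a b γ)
sorting-prefix-preserves-subadditive a b u γ lu ou sub i j le =
  subadditive-from-below (length (u ++ γ)) (P (blocks a b γ)) (P (u ++ γ)) below sub cases
    i j (subst (j + i ≤_) same-length le)
  where
  same-length : length (blocks a b γ) ≡ length (u ++ γ)
  same-length = trans (length-blocks a b γ) (trans (cong (_+ length γ) (sym lu)) (sym (length-++ u)))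
  P-u++γ : ∀ k → P (u ++ γ) k ≡ P u k + P γ (k ∸ (a + b))
  P-u++γ k = trans (P-++ u γ k) (cong (λ q → P u k + P γ (k ∸ q)) lu)
  below : ∀ k → P (u ++ γ) k ≤ P (blocks a b γ) k
  below k rewrite P-u++γ k | P-blocks a b γ k =
    +-monoˡ-≤ _ (⊓-glb (P≤ u k) (subst (P u k ≤_) ou (P≤ones u k)))
  cases : ∀ i j → j + i ≤ length (u ++ γ) →
    P (blocks a b γ) (j + i) ≤ P (u ++ γ) (j + i) ⊎ P (blocks a b γ) (j + i) ≤ P (blocks a b γ) j + P (blocks a b γ) i
  cases i j _ with j + i ≤? a + b
  ... | yes within = inj₂ (blocks-subadditive a b γ i j within)
  ... | no beyond = inj₁ (≤-reflexive (trans (P-blocks a b γ (j + i))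
                      (trans (cong (_+ _) all-of-u) (sym (P-u++γ (j + i))))))
    where
    a+b≤ : a + b ≤ j + i
    a+b≤ = <⇒≤ (≰⇒> beyond)
    all-of-u : (j + i) ⊓ a ≡ P u (j + i)
    all-of-u = trans (m≥n⇒m⊓n≡n (≤-trans (m≤m+n a b) a+b≤))
      (sym (trans (P-beyond-length u (j + i) (subst (_≤ j + i) (sym lu) a+b≤)) ou))

childSuffix : ℕ → ℕ → Word → Word
childSuffix t x γ = true ∷ (replicate (t ∸ x) false ++ γ)

child : ℕ → ℕ → ℕ → Word → Word
child s′ t x γ = blocks s′ x (childSuffix t x γ)

P-zeros-childSuffix : ∀ t x γ k → x ≤ t →
  P (replicate x false ++ childSuffix t x γ) k ≡ (k ∸ x) ⊓ 1 + P γ (k ∸ suc t)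
P-zeros-childSuffix t x γ k x≤t with k ≤? x
... | yes k≤x rewrite P-replicate-false-++ x (childSuffix t x γ) k | m≤n⇒m∸n≡0 k≤x
                    | m≤n⇒m∸n≡0 (≤-trans k≤x (m≤n⇒m≤1+n x≤t)) = refl
... | no k≰x with ≤-offset (≰⇒> k≰x)
...   | q , refl rewrite P-replicate-false-++ x (childSuffix t x γ) (suc x + q)
        | sym (+-suc x q) | m+n∸m≡n x (suc q) | ⊓-zeroʳ q | P-replicate-false-++ (t ∸ x) γ q =
  cong (λ r → suc (P γ r)) (sym past-t)
  where
  past-t : (x + q) ∸ t ≡ q ∸ (t ∸ x)
  past-t = trans (cong ((x + q) ∸_) (sym (m+[n∸m]≡n x≤t))) ([m+n]∸[m+o]≡n∸o x q (t ∸ x))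

length-child : ∀ s′ t x γ → x ≤ t → length (child s′ t x γ) ≡ s′ + suc t + length γ
length-child s′ t x γ x≤t = begin
  length (child s′ t x γ)
    ≡⟨ length-blocks s′ x _ ⟩
  s′ + x + suc (length (replicate (t ∸ x) false ++ γ))
    ≡⟨ cong (λ q → s′ + x + suc q) (length-++ (replicate (t ∸ x) false)) ⟩
  s′ + x + suc (length (replicate (t ∸ x) false) + length γ)
    ≡⟨ cong (λ q → s′ + x + suc (q + length γ)) (length-replicate (t ∸ x)) ⟩
  s′ + x + suc ((t ∸ x) + length γ)
    ≡⟨ regroup s′ x (t ∸ x) (length γ) ⟩
  s′ + suc (x + (t ∸ x)) + length γ
    ≡⟨ cong (λ q → s′ + suc q + length γ) (m+[n∸m]≡n x≤t) ⟩
  s′ + suc t + length γ ∎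
  where open ≡-Reasoning
        regroup : ∀ s x d g → s + x + suc (d + g) ≡ s + suc (x + d) + g
        regroup = solve-∀

P-child : ∀ s′ t x γ k → x ≤ t →
  P (child s′ t x γ) k ≡ k ⊓ s′ + ((k ∸ s′ ∸ x) ⊓ 1 + P γ (k ∸ s′ ∸ suc t))
P-child s′ t x γ k x≤t =
  trans (P-replicate-true-++ s′ _ k) (cong (k ⊓ s′ +_) (P-zeros-childSuffix t x γ (k ∸ s′) x≤t))

<+⇒<⊓+⊓ : ∀ s x y → 1 ≤ s → 1 ≤ x → 1 ≤ y → s < x + y → suc s ≤ x ⊓ s + y ⊓ s
<+⇒<⊓+⊓ s x y 1≤s 1≤x 1≤y s<x+y with x ≤? s | y ≤? s
... | no x≰s | _ rewrite m≥n⇒m⊓n≡n (<⇒≤ (≰⇒> x≰s)) =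
  subst (_≤ s + y ⊓ s) (+-comm s 1) (+-monoʳ-≤ s (⊓-glb 1≤y 1≤s))
... | yes _ | no y≰s rewrite m≥n⇒m⊓n≡n (<⇒≤ (≰⇒> y≰s)) = +-monoˡ-≤ s (⊓-glb 1≤x 1≤s)
... | yes x≤s | yes y≤s rewrite m≤n⇒m⊓n≡m x≤s | m≤n⇒m⊓n≡m y≤s = s<x+y

leading-zero-not-subadditive : ∀ t j γ → 1 ≤ j → j ≤ t → ¬ Subadditive (child 0 t j γ)
leading-zero-not-subadditive t j γ 1≤j j≤t sub = <⇒≱ (s≤s z≤n) (subst₂ _≤_ P-after P-before (sub 1 j fits))
  where
  X = replicate j false ++ childSuffix t j γ
  fits : j + 1 ≤ length X
  fits = subst (j + 1 ≤_) (sym (length-child 0 t j γ j≤t))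
    (≤-trans (≤-reflexive (+-comm j 1)) (≤-trans (s≤s j≤t) (m≤m+n _ _)))
  P-after : P X (j + 1) ≡ 1
  P-after = trans (P-replicate-false-++ j _ (j + 1)) (cong (P (childSuffix t j γ)) (m+n∸m≡n j 1))
  P-before : P X j + P X 1 ≡ 0
  P-before = cong₂ _+_ (trans (P-replicate-false-++ j _ j) (cong (P (childSuffix t j γ)) (n∸n≡0 j)))
                       (trans (P-replicate-false-++ j _ 1) (cong (P (childSuffix t j γ)) (m≤n⇒m∸n≡0 1≤j)))

-- The i-th child has at least the prefix counts of the j-th; they differ only for lengths between the
-- two moved 1s, where the i-th child has at most s′ + 1 ones in its prefix, already matched by any two
-- nonempty prefixes of total length beyond s′.
child-subadditive-antitone : ∀ s′ t i j γ → 1 ≤ i → i ≤ j → j ≤ t →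
  Subadditive (child s′ t j γ) → Subadditive (child s′ t i γ)
child-subadditive-antitone zero t i j γ 1≤i i≤j j≤t sub =
  ⊥-elim (leading-zero-not-subadditive t j γ (≤-trans 1≤i i≤j) j≤t sub)
child-subadditive-antitone s′@(suc _) t i j γ 1≤i i≤j j≤t sub =
  subadditive-from-below (length (child s′ t i γ)) Q R R≤Q
    (λ ℓ k le → sub ℓ k (subst (k + ℓ ≤_) same-length le)) cases
  where
  Q = P (child s′ t i γ)
  R = P (child s′ t j γ)
  i≤t = ≤-trans i≤j j≤t
  same-length : length (child s′ t i γ) ≡ length (child s′ t j γ)
  same-length = trans (length-child s′ t i γ i≤t) (sym (length-child s′ t j γ j≤t))
  R≤Q : ∀ k → R k ≤ Q k
  R≤Q k rewrite P-child s′ t i γ k i≤t | P-child s′ t j γ k j≤t =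
    +-monoʳ-≤ (k ⊓ s′) (+-monoˡ-≤ _ (⊓-monoˡ-≤ 1 (∸-monoʳ-≤ (k ∸ s′) i≤j)))
  head≤Q : ∀ x → x ⊓ s′ ≤ Q x
  head≤Q x rewrite P-child s′ t i γ x i≤t = m≤m+n _ _
  past : ∀ k x → s′ + x < k → 1 ≤ k ∸ s′ ∸ x
  past k x lt rewrite ∸-+-assoc k s′ x = m+n≤o⇒m≤o∸n 1 lt
  cases : ∀ ℓ k → k + ℓ ≤ length (child s′ t i γ) → Q (k + ℓ) ≤ R (k + ℓ) ⊎ Q (k + ℓ) ≤ Q k + Q ℓ
  cases ℓ zero _ = inj₂ ≤-refl
  cases zero k _ rewrite +-identityʳ k = inj₂ (m≤m+n _ _)
  cases (suc ℓ′) (suc k′) _ with suc k′ + suc ℓ′ ≤? s′ + i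
  ... | yes before-i = inj₁ (subst₂ _≤_ (sym (P-child s′ t i γ x i≤t)) (sym (P-child s′ t j γ x j≤t))
          (+-monoʳ-≤ (x ⊓ s′) (+-monoˡ-≤ (P γ (x ∸ s′ ∸ suc t)) (≤-trans (≤-reflexive (cong (_⊓ 1) x∸s′∸i)) z≤n))))
    where
    x = suc k′ + suc ℓ′
    x∸s′∸i : x ∸ s′ ∸ i ≡ 0
    x∸s′∸i = m≤n⇒m∸n≡0 (subst (x ∸ s′ ≤_) (m+n∸m≡n s′ i) (∸-monoˡ-≤ s′ before-i))
  ... | no after-i with suc k′ + suc ℓ′ ≤? s′ + j
  ...   | no after-j rewrite P-child s′ t i γ (suc k′ + suc ℓ′) i≤t | P-child s′ t j γ (suc k′ + suc ℓ′) j≤t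
          | m≥n⇒m⊓n≡n (past (suc k′ + suc ℓ′) i (≰⇒> after-i))
          | m≥n⇒m⊓n≡n (past (suc k′ + suc ℓ′) j (≰⇒> after-j)) = inj₁ ≤-refl
  ...   | yes before-j = inj₂ (≤-trans Qx≤ (≤-trans (<+⇒<⊓+⊓ s′ (suc k′) (suc ℓ′) (s≤s z≤n) (s≤s z≤n) (s≤s z≤n) s′<x)
                           (+-mono-≤ (head≤Q (suc k′)) (head≤Q (suc ℓ′)))))
    where
    x = suc k′ + suc ℓ′
    s′<x : s′ < x
    s′<x = ≤-trans (s≤s (m≤m+n s′ i)) (≰⇒> after-i)
    x∸s′∸t : x ∸ s′ ∸ suc t ≡ 0
    x∸s′∸t = trans (∸-+-assoc x s′ (suc t)) (m≤n⇒m∸n≡0 (≤-trans before-j (+-monoʳ-≤ s′ (m≤n⇒m≤1+n j≤t))))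
    Qx≤ : Q x ≤ suc s′
    Qx≤ = ≤-trans (≤-reflexive (P-child s′ t i γ x i≤t))
            (≤-trans (+-mono-≤ (m⊓n≤n x s′) (+-mono-≤ (m⊓n≤n _ 1) (≤-reflexive (cong (P γ) x∸s′∸t))))
              (≤-reflexive (+-comm s′ 1)))

Enumerates : (Word → Set) → List Word → Set
Enumerates S ws = Unique ws × (∀ w → w ∈ ws → S w) × (∀ w → S w → w ∈ ws)

enumerates-[] : ∀ {S : Word → Set} → (∀ w → ¬ S w) → Enumerates S []
enumerates-[] none = AllPairs.[] , (λ _ ()) , λ w s → ⊥-elim (none w s)

enumerates-singleton : ∀ {S : Word → Set} v → S v → (∀ w → S w → w ≡ v) → Enumerates S (v ∷ [])
enumerates-singleton v sv only = All.[] AllPairs.∷ AllPairs.[] , (λ { w (here refl) → sv }) , λ w s → here (only w s)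

enumerates-++ : ∀ {S₁ S₂ S : Word → Set} {xs ys} → Enumerates S₁ xs → Enumerates S₂ ys →
  (∀ w → S₁ w → ¬ S₂ w) → (∀ w → S₁ w ⊎ S₂ w → S w) → (∀ w → S w → S₁ w ⊎ S₂ w) →
  Enumerates S (xs ++ ys)
enumerates-++ {xs = xs} (u₁ , sound₁ , complete₁) (u₂ , sound₂ , complete₂) disjoint join split =
  ++⁺ u₁ u₂ (λ (m₁ , m₂) → disjoint _ (sound₁ _ m₁) (sound₂ _ m₂)) , sound , complete
  where
  sound : ∀ w → w ∈ xs ++ _ → _
  sound w m with ∈-++⁻ xs m
  ... | inj₁ m₁ = join w (inj₁ (sound₁ w m₁))
  ... | inj₂ m₂ = join w (inj₂ (sound₂ w m₂))
  complete : ∀ w → _ → w ∈ xs ++ _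
  complete w s with split w s
  ... | inj₁ s₁ = ∈-++⁺ˡ (complete₁ w s₁)
  ... | inj₂ s₂ = ∈-++⁺ʳ xs (complete₂ w s₂)

InSubtree : ℕ → ℕ → Word → Word → Set
InSubtree s t γ w = Σ Word λ u → length u ≡ s + t × ones u ≡ s × w ≡ u ++ γ × Subadditive w

ChildSubtrees : ℕ → ℕ → ℕ → Word → Word → Set
ChildSubtrees s′ t i γ w = Σ ℕ λ j → i ≤ j × j ≤ t × InSubtree s′ j (childSuffix t j γ) w

SplitsAt : ℕ → ℕ → Word → ℕ → Word → Set
SplitsAt s′ t γ i w = Σ Word λ u → length u ≡ s′ + i × w ≡ u ++ childSuffix t i γ

inSubtree⇒splitsAt : ∀ s′ t γ j w → InSubtree s′ j (childSuffix t j γ) w → SplitsAt s′ t γ j w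
inSubtree⇒splitsAt s′ t γ j w (u , lu , _ , w≡ , _) = u , lu , w≡

-- at position s′ + j the first word has its moved 1, the second still a 0
splitsAt-unique : ∀ s′ t γ i j w → i < j → j ≤ t → SplitsAt s′ t γ i w → ¬ SplitsAt s′ t γ j w
splitsAt-unique s′ t γ i j w i<j j≤t (u₁ , l₁ , w≡₁) (u₂ , l₂ , w≡₂) with ≤-offset i<j
... | d , refl with drop-inside-replicate-false d (t ∸ i) γ d<t∸i
  where d<t∸i : d < t ∸ i
        d<t∸i = m+n≤o⇒m≤o∸n (suc d) (subst (_≤ t) (cong suc (+-comm i d)) j≤t)
... | r , dropped with trans (sym at-one) at-zero
  where
  at-one : drop (s′ + suc (i + d)) w ≡ childSuffix t (suc (i + d)) γ
  at-one = trans (cong₂ drop (trans (sym l₂) (sym (+-identityʳ _))) w≡₂) (drop-++ u₂ 0 _)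
  at-zero : drop (s′ + suc (i + d)) w ≡ false ∷ r
  at-zero = trans (cong₂ drop (trans (cong (s′ +_) (sym (+-suc i d)))
              (trans (sym (+-assoc s′ i (suc d))) (cong (_+ suc d) (sym l₁)))) w≡₁)
              (trans (drop-++ u₁ (suc d) _) dropped)
... | ()

replicate-true-++-true : ∀ s (v : Word) → replicate s true ++ (true ∷ v) ≡ true ∷ (replicate s true ++ v)
replicate-true-++-true zero    v = refl
replicate-true-++-true (suc s) v = cong (true ∷_) (replicate-true-++-true s v)

node-splitsAt-0 : ∀ s′ t info → SplitsAt s′ t (γ info) 0 (node (suc s′) t info)
node-splitsAt-0 s′ t info = replicate s′ true , trans (length-replicate s′) (sym (+-identityʳ s′)) ,
  sym (replicate-true-++-true s′ (replicate t false ++ γ info))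

node-inSubtree : ∀ s t γ → Subadditive (blocks s t γ) → InSubtree s t γ (blocks s t γ)
node-inSubtree s t γ sub = replicate s true ++ replicate t false ,
  trans (length-++ (replicate s true)) (cong₂ _+_ (length-replicate s) (length-replicate t)) ,
  trans (ones-++ (replicate s true) _)
    (trans (cong₂ _+_ (ones-replicate-true s) (ones-replicate-false t)) (+-identityʳ s)) ,
  sym (++-assoc (replicate s true) (replicate t false) γ) , sub

childSubtree⊆subtree : ∀ s′ t j γ w → j ≤ t → InSubtree s′ j (childSuffix t j γ) w → InSubtree (suc s′) t γ w
childSubtree⊆subtree s′ t j γ w j≤t (u , lu , ou , w≡ , sub) =
  u ++ head ,
  trans (length-++ u) (trans (cong₂ _+_ lu (cong suc (length-replicate (t ∸ j))))
    (trans (regroup s′ j (t ∸ j)) (cong (λ q → suc (s′ + q)) (m+[n∸m]≡n j≤t)))) ,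
  trans (ones-++ u _) (trans (cong₂ _+_ ou (cong suc (ones-replicate-false (t ∸ j)))) (+-comm s′ 1)) ,
  trans w≡ (sym (++-assoc u head γ)) , sub
  where head = true ∷ replicate (t ∸ j) false
        regroup : ∀ s j d → s + j + suc d ≡ suc (s + (j + d))
        regroup = solve-∀

root-or-child : ∀ s′ t γ w u z → ones u ≡ s′ → length u + suc z ≡ s′ + suc t →
  w ≡ u ++ (true ∷ (replicate z false ++ γ)) → Subadditive w →
  w ≡ blocks (suc s′) t γ ⊎ ChildSubtrees s′ t 1 γ w
root-or-child s′ t γ w u z ou lu w≡ sub with m≤n⇒m<n∨m≡n z≤t
  where
  z≤t : z ≤ t
  z≤t = ≤-pred (+-cancelˡ-≤ s′ _ _
          (≤-trans (+-monoˡ-≤ (suc z) (subst (_≤ length u) ou (ones≤length u))) (≤-reflexive lu)))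
... | inj₂ refl = inj₁ (trans w≡ (trans (cong (_++ (true ∷ (replicate z false ++ γ))) all-ones)
                    (replicate-true-++-true s′ _)))
  where
  lu′ : length u ≡ s′
  lu′ = +-cancelʳ-≡ (suc z) (length u) s′ lu
  all-ones : u ≡ replicate s′ true
  all-ones = trans (ones≡length⇒all-true u (trans ou (sym lu′))) (cong (λ q → replicate q true) lu′)
... | inj₁ z<t = inj₂ (t ∸ z , m<n⇒0<n∸m z<t , m∸n≤m t z ,
        u , +-cancelʳ-≡ (suc z) _ _ (trans lu regroup) , ou ,
        trans w≡ (cong (λ q → u ++ (true ∷ (replicate q false ++ γ))) (sym (m∸[m∸n]≡n (<⇒≤ z<t)))) , sub)
  where
  regroup : s′ + suc t ≡ s′ + (t ∸ z) + suc z
  regroup = trans (cong (λ q → s′ + suc q) (sym (m∸n+n≡m (<⇒≤ z<t)))) (shift s′ (t ∸ z) z)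
    where shift : ∀ s d z → s + suc (d + z) ≡ s + d + suc z
          shift = solve-∀

-- Split off the last 1 of the prefix: either all 1s precede all 0s, or it is the moved 1 of a child.
subtree⊆root∪children : ∀ s′ t γ w → InSubtree (suc s′) t γ w →
  w ≡ blocks (suc s′) t γ ⊎ ChildSubtrees s′ t 1 γ w
subtree⊆root∪children s′ t γ w (u , lu , ou , w≡ , sub) with last-one u (subst (1 ≤_) (sym ou) (s≤s z≤n))
... | u′ , z , u≡ = root-or-child s′ t γ w u′ z ou′ lu′ (trans w≡ (trans (cong (_++ γ) u≡) (++-assoc u′ _ γ))) sub
  where
  ou′ : ones u′ ≡ s′
  ou′ = suc-injective (trans (+-comm 1 (ones u′)) (trans (cong (λ q → ones u′ + suc q) (sym (ones-replicate-false z)))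
          (trans (sym (ones-++ u′ _)) (trans (cong ones (sym u≡)) ou))))
  lu′ : length u′ + suc z ≡ s′ + suc t
  lu′ = trans (cong (λ q → length u′ + suc q) (sym (length-replicate z)))
          (trans (sym (length-++ u′)) (trans (cong length (sym u≡)) (trans lu (sym (+-suc s′ t)))))

childSubtrees-join : ∀ s′ t i γ → i ≤ t → ∀ w →
  InSubtree s′ i (childSuffix t i γ) w ⊎ ChildSubtrees s′ t (suc i) γ w → ChildSubtrees s′ t i γ w
childSubtrees-join s′ t i γ i≤t w (inj₁ sub₁)                  = i , ≤-refl , i≤t , sub₁
childSubtrees-join s′ t i γ i≤t w (inj₂ (j , i<j , j≤t , there)) = j , <⇒≤ i<j , j≤t , there

childSubtrees-split : ∀ s′ t i γ w →
  ChildSubtrees s′ t i γ w → InSubtree s′ i (childSuffix t i γ) w ⊎ ChildSubtrees s′ t (suc i) γ w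
childSubtrees-split s′ t i γ w (j , i≤j , j≤t , there) with i ≟ j
... | yes refl = inj₁ there
... | no i≢j   = inj₂ (j , ≤∧≢⇒< i≤j i≢j , j≤t , there)

mutual
  visit-enumerates : ∀ s t info → Tabulates info → Subadditive (node s t info) →
    Enumerates (InSubtree s t (γ info)) (proj₁ (visit s t info))
  visit-enumerates zero t info tab sub = enumerates-singleton _ (node-inSubtree 0 t (γ info) sub) only
    where
    only : ∀ w → InSubtree 0 t (γ info) w → w ≡ node 0 t info
    only w (u , lu , ou , w≡ , _) = trans w≡ (cong (_++ γ info)
      (trans (ones≡0⇒all-false u ou) (cong (λ q → replicate q false) lu)))
  visit-enumerates (suc s′) t info tab sub =
    enumerates-++ (enumerates-singleton _ refl (λ _ w≡ → w≡)) (kids-enumerates s′ t 1 t info tab (s≤s z≤n) refl)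
      (λ { w refl (j , 1≤j , j≤t , there) → splitsAt-unique s′ t (γ info) 0 j w 1≤j j≤t
             (node-splitsAt-0 s′ t info) (inSubtree⇒splitsAt s′ t (γ info) j w there) })
      (λ { w (inj₁ refl) → node-inSubtree (suc s′) t (γ info) sub
         ; w (inj₂ (j , _ , j≤t , there)) → childSubtree⊆subtree s′ t j (γ info) w j≤t there })
      (subtree⊆root∪children s′ t (γ info))

  kids-enumerates : ∀ s′ t i k info → Tabulates info → 1 ≤ i → i + k ≡ suc t →
    Enumerates (ChildSubtrees s′ t i (γ info)) (proj₁ (kids s′ t i k info))
  kids-enumerates s′ t i zero info tab 1≤i i+0≡ = enumerates-[] λ { w (j , i≤j , j≤t , _) →
    <⇒≱ (s≤s j≤t) (subst (_≤ j) (trans (sym (+-identityʳ i)) i+0≡) i≤j) }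
  kids-enumerates s′ t i (suc k) info tab 1≤i i+k≡ =
    kidsStep-enumerates s′ t i k info tab 1≤i i+k≡ (childTest (suc s′) t i info) refl

  kidsStep-enumerates : ∀ s′ t i k info → Tabulates info → 1 ≤ i → i + suc k ≡ suc t →
    ∀ r → r ≡ childTest (suc s′) t i info →
    Enumerates (ChildSubtrees s′ t i (γ info))
      (proj₁ (kidsStep r (visit s′ i (extend (t ∸ i) info)) (kids s′ t (suc i) k info) (extendCost (t ∸ i) info)))
  kidsStep-enumerates s′ t i k info tab 1≤i i+k≡ (true , _) test =
    enumerates-++
      (visit-enumerates s′ i (extend (t ∸ i) info) (Extend.extend-tabulates (t ∸ i) info tab)
        (ChildTest.childTest-true s′ t i info tab i≤t (cong proj₁ (sym test))))
      (kids-enumerates s′ t (suc i) k info tab (s≤s z≤n) (trans (sym (+-suc i k)) i+k≡))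
      (λ w sub₁ (j , i<j , j≤t , there) → splitsAt-unique s′ t (γ info) i j w i<j j≤t
         (inSubtree⇒splitsAt s′ t (γ info) i w sub₁) (inSubtree⇒splitsAt s′ t (γ info) j w there))
      (childSubtrees-join s′ t i (γ info) i≤t)
      (childSubtrees-split s′ t i (γ info))
    where i≤t : i ≤ t
          i≤t = subst (i ≤_) (suc-injective (trans (sym (+-suc i k)) i+k≡)) (m≤m+n i k)
  -- no later child is prefix normal either, so stopping loses nothing
  kidsStep-enumerates s′ t i k info tab 1≤i i+k≡ (false , _) test =
    enumerates-[] λ { w (j , i≤j , j≤t , (u , lu , ou , w≡ , sub)) →
      ChildTest.childTest-false s′ t i info tab (≤-trans i≤j j≤t) (cong proj₁ (sym test))
        (child-subadditive-antitone s′ t i j (γ info) 1≤i i≤j j≤t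
          (sorting-prefix-preserves-subadditive s′ j u (childSuffix t j (γ info)) lu ou (subst Subadditive w≡ sub))) }

AtDensities : ℕ → ℕ → ℕ → Word → Set
AtDensities n d k w = Σ ℕ λ d′ → d ≤ d′ × d′ < d + k × InSubtree d′ (n ∸ d′) [] w

ones-inSubtree : ∀ s t w → InSubtree s t [] w → ones w ≡ s
ones-inSubtree s t w (u , _ , ou , w≡ , _) =
  trans (cong ones w≡) (trans (ones-++ u []) (trans (+-identityʳ _) ou))

densities-enumerates : ∀ n d k → Enumerates (AtDensities n d k) (proj₁ (densities n d k))
densities-enumerates n d zero = enumerates-[] λ { w (d′ , d≤d′ , d′<d+0 , _) →
  <⇒≱ d′<d+0 (subst (_≤ d′) (sym (+-identityʳ d)) d≤d′) }
densities-enumerates n d (suc k) =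
  enumerates-++
    (visit-enumerates d (n ∸ d) emptyInfo emptyInfo-tabulates (blocks-[]-subadditive d (n ∸ d)))
    (densities-enumerates n (suc d) k)
    (λ w first (d′ , d<d′ , _ , rest) → <⇒≢ d<d′
       (trans (sym (ones-inSubtree d (n ∸ d) w first)) (ones-inSubtree d′ (n ∸ d′) w rest)))
    join split
  where
  join : ∀ w → InSubtree d (n ∸ d) [] w ⊎ AtDensities n (suc d) k w → AtDensities n d (suc k) w
  join w (inj₁ first) = d , ≤-refl , m<m+n d (s≤s z≤n) , first
  join w (inj₂ (d′ , d<d′ , d′< , rest)) = d′ , <⇒≤ d<d′ , subst (d′ <_) (sym (+-suc d k)) d′< , rest
  split : ∀ w → AtDensities n d (suc k) w → InSubtree d (n ∸ d) [] w ⊎ AtDensities n (suc d) k w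
  split w (d′ , d≤d′ , d′< , there) with d ≟ d′
  ... | yes refl = inj₁ there
  ... | no d≢d′  = inj₂ (d′ , ≤∧≢⇒< d≤d′ d≢d′ , subst (d′ <_) (+-suc d k) d′< , there)

length-node-child : ∀ s′ t i g₀ → i ≤ t → s′ + i + suc ((t ∸ i) + g₀) ≡ suc s′ + t + g₀
length-node-child s′ t i g₀ i≤t = trans (regroup s′ i (t ∸ i) g₀) (cong (λ q → suc s′ + q + g₀) (m+[n∸m]≡n i≤t))
  where regroup : ∀ s i d g → s + i + suc (d + g) ≡ suc s + (i + d) + g
        regroup = solve-∀

-- One loop over the children of a node of length N: a successful child costs its test (c ≤ N), its
-- arrays (e ≤ N + 1) and its subtree, which has a surplus of 4N; the rest of the loop leaves N over.
children-steps-step : ∀ N c e Tc Tr Lc Lr → 1 ≤ N → c ≤ N → e ≤ suc N →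
  Tc + 4 * N ≤ 6 * N * Lc → Tr ≤ 6 * N * Lr + N → c + e + Tc + Tr ≤ 6 * N * (Lc + Lr) + N
children-steps-step N c e Tc Tr Lc Lr 1≤N c≤N e≤N Tc≤ Tr≤ = +-cancelʳ-≤ (4 * N) _ _ (begin
  c + e + Tc + Tr + 4 * N                      ≡⟨ regroup c e Tc Tr N ⟩
  (c + e) + (Tc + 4 * N) + Tr                  ≤⟨ +-mono-≤ (+-mono-≤ (+-mono-≤ c≤N e≤N) Tc≤) Tr≤ ⟩
  (N + suc N) + 6 * N * Lc + (6 * N * Lr + N)  ≡⟨ collect N Lc Lr ⟩
  6 * N * (Lc + Lr) + (3 * N + 1)              ≤⟨ +-monoʳ-≤ (6 * N * (Lc + Lr)) (+-mono-≤ (m≤m+n (3 * N) N) 1≤N) ⟩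
  6 * N * (Lc + Lr) + (3 * N + N + N)          ≡⟨ regroup′ N (Lc + Lr) ⟩
  6 * N * (Lc + Lr) + N + 4 * N                ∎)
  where
  open ≤-Reasoning
  regroup : ∀ c e Tc Tr N → c + e + Tc + Tr + 4 * N ≡ (c + e) + (Tc + 4 * N) + Tr
  regroup = solve-∀
  collect : ∀ N Lc Lr → (N + suc N) + 6 * N * Lc + (6 * N * Lr + N) ≡ 6 * N * (Lc + Lr) + (3 * N + 1)
  collect = solve-∀
  regroup′ : ∀ N L → 6 * N * L + (3 * N + N + N) ≡ 6 * N * L + N + 4 * N
  regroup′ = solve-∀

-- Each output word of length N pays 6N steps, leaving a surplus of 4N per visited subtree.
mutual
  visit-steps : ∀ s t info → 1 ≤ nodeLen s t info →
    proj₂ (visit s t info) + 4 * nodeLen s t info ≤ 6 * nodeLen s t info * length (proj₁ (visit s t info))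
  visit-steps zero t info _ = subst (t + g info + 4 * (t + g info) ≤_) (sym (collect (t + g info))) (m≤m+n _ _)
    where collect : ∀ N → 6 * N * 1 ≡ (N + 4 * N) + N
          collect = solve-∀
  visit-steps (suc s′) t info 1≤N = ≤-trans
    (+-monoˡ-≤ (4 * N) (+-monoʳ-≤ N (kids-steps s′ t 1 t info ≤-refl 1≤N)))
    (≤-reflexive (collect N (length (proj₁ (kids s′ t 1 t info)))))
    where N = suc s′ + t + g info
          collect : ∀ N L → N + (6 * N * L + N) + 4 * N ≡ 6 * N * suc L
          collect = solve-∀

  kids-steps : ∀ s′ t i k info → i + k ≤ suc t → 1 ≤ suc s′ + t + g info →
    proj₂ (kids s′ t i k info) ≤
      6 * (suc s′ + t + g info) * length (proj₁ (kids s′ t i k info)) + (suc s′ + t + g info)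
  kids-steps s′ t i zero    info _ _ = z≤n
  kids-steps s′ t i (suc k) info i+k≤ 1≤N = kidsStep-steps s′ t i k info i+k≤ 1≤N (childTest (suc s′) t i info)
    (checkLoop-steps≤ (suc s′ + t + g info) 1 (ChildTestTables.cond (suc s′) t i info))

  kidsStep-steps : ∀ s′ t i k info → i + suc k ≤ suc t → 1 ≤ suc s′ + t + g info →
    ∀ r → proj₂ r ≤ suc s′ + t + g info →
    let step = kidsStep r (visit s′ i (extend (t ∸ i) info)) (kids s′ t (suc i) k info) (extendCost (t ∸ i) info)
    in proj₂ step ≤ 6 * (suc s′ + t + g info) * length (proj₁ step) + (suc s′ + t + g info)
  kidsStep-steps s′ t i k info _ _ (false , c) c≤N = ≤-trans c≤N (m≤n+m _ _)
  kidsStep-steps s′ t i k info i+k≤ 1≤N (true , c) c≤N =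
    subst (λ L → c + extendCost (t ∸ i) info + proj₂ subtree + proj₂ rest ≤ 6 * N * L + N)
      (sym (length-++ (proj₁ subtree)))
      (children-steps-step N c (extendCost (t ∸ i) info) _ _ _ _ 1≤N c≤N e≤N subtree≤
        (kids-steps s′ t (suc i) k info (subst (_≤ suc t) (+-suc i k) i+k≤) 1≤N))
    where
    N = suc s′ + t + g info
    subtree = visit s′ i (extend (t ∸ i) info)
    rest = kids s′ t (suc i) k info
    i≤t : i ≤ t
    i≤t = ≤-pred (≤-trans (subst (_≤ i + suc k) (+-comm i 1) (+-monoʳ-≤ i (s≤s (z≤n {k})))) i+k≤)
    same-length : nodeLen s′ i (extend (t ∸ i) info) ≡ N
    same-length = length-node-child s′ t i (g info) i≤t
    e≤N : extendCost (t ∸ i) info ≤ suc N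
    e≤N = s≤s (s≤s (+-monoˡ-≤ (g info) (≤-trans (m∸n≤m t i) (m≤n+m t s′))))
    subtree≤ : proj₂ subtree + 4 * N ≤ 6 * N * length (proj₁ subtree)
    subtree≤ = subst (λ M → proj₂ subtree + 4 * M ≤ 6 * M * length (proj₁ subtree)) same-length
      (visit-steps s′ i (extend (t ∸ i) info) (subst (1 ≤_) (sym same-length) 1≤N))

densities-steps : ∀ n d k → 1 ≤ n → d + k ≤ suc n →
  proj₂ (densities n d k) ≤ 6 * n * length (proj₁ (densities n d k))
densities-steps n d zero    _   _    = z≤n
densities-steps n d (suc k) 1≤n d+k≤ = subst (suc (proj₂ root) + proj₂ rest ≤_)
  (trans (sym (*-distribˡ-+ (6 * n) _ _)) (cong (6 * n *_) (sym (length-++ (proj₁ root)))))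
  (+-mono-≤ root≤ (densities-steps n (suc d) k 1≤n (subst (_≤ suc n) (+-suc d k) d+k≤)))
  where
  root = visit d (n ∸ d) emptyInfo
  rest = densities n (suc d) k
  d≤n : d ≤ n
  d≤n = ≤-pred (≤-trans (subst (_≤ d + suc k) (+-comm d 1) (+-monoʳ-≤ d (s≤s (z≤n {k})))) d+k≤)
  length-root : nodeLen d (n ∸ d) emptyInfo ≡ n
  length-root = trans (+-identityʳ _) (m+[n∸m]≡n d≤n)
  root+4n≤ : proj₂ root + 4 * n ≤ 6 * n * length (proj₁ root)
  root+4n≤ = subst (λ N → proj₂ root + 4 * N ≤ 6 * N * length (proj₁ root)) length-root
    (visit-steps d (n ∸ d) emptyInfo (subst (1 ≤_) (sym length-root) 1≤n))
  root≤ : suc (proj₂ root) ≤ 6 * n * length (proj₁ root)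
  root≤ = ≤-trans (subst (_≤ proj₂ root + 4 * n) (+-comm (proj₂ root) 1)
            (+-monoʳ-≤ (proj₂ root) (≤-trans 1≤n (m≤m+n n (3 * n))))) root+4n≤

atDensities⇒prefixNormal : ∀ n w → AtDensities n 0 (suc n) w → length w ≡ n × PrefixNormal w
atDensities⇒prefixNormal n w (d , _ , d<1+n , (u , lu , _ , w≡ , sub)) =
  trans (cong length w≡) (trans (length-++ u) (trans (+-identityʳ _) (trans lu (m+[n∸m]≡n (≤-pred d<1+n))))) ,
  subadditive⇒prefixNormal w sub

prefixNormal⇒atDensities : ∀ n w → length w ≡ n → PrefixNormal w → AtDensities n 0 (suc n) w
prefixNormal⇒atDensities n w lw pn =
  ones w , z≤n , s≤s ones≤n ,
  w , trans lw (sym (m+[n∸m]≡n ones≤n)) , refl , sym (++-identityʳ w) , prefixNormal⇒subadditive w pn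
  where ones≤n : ones w ≤ n
        ones≤n = subst (ones w ≤_) lw (ones≤length w)

theorem1 : Σ ℕ λ C → (n : ℕ) → 1 ≤ n →
    Unique (generatePN-output n)
    × ((w : Word) → (w ∈ generatePN-output n) ⇔ (length w ≡ n × PrefixNormal w))
    × generatePN-time n ≤ C * n * length (generatePN-output n)
theorem1 = 6 , λ n 1≤n →
  let unique , sound , complete = densities-enumerates n 0 (suc n) in
  unique ,
  (λ w → mk⇔ (λ w∈ → atDensities⇒prefixNormal n w (sound w w∈))
             (λ (lw , pn) → complete w (prefixNormal⇒atDensities n w lw pn))) ,
  densities-steps n 0 (suc n) 1≤n ≤-refl
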